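{- Let $q \geq 2$ be an integer and let $\Sigma$ be an alphabet of size $q$. For a positive integer $N$, let $p$ be the unique integer such that \[ \frac{\ln q}{q-1}\,q^p \leq N < \frac{\ln q}{q-1}\,q^{p+1}, \] and let $n = N + p$. There exist constants $N_0$ and $d > 0$ (which may depend on $q$ but not on $N$) such that for every $N > N_0$ and every word $P \in \Sigma^p$, \[ G_P(N) \geq \frac{d\,q^n}{n^2}. \]
   Context: For a word $P = a_1 \cdots a_p$ over an alphabet $\Sigma$ of size $q$ and a positive integer $N > p$, $G_P(N)$ denotes the number of words $a_1 a_2 \cdots a_{N+p} \in \Sigma^{N+p}$ such that $a_k a_{k+1} \cdots a_{k+p-1} = P$ for $k = 1$ and for $k = N+1$, and for no other $k$ with $1 \leq k \leq N+1$. Equivalently, $G_P(N)$ is the size of a maximal prefix-synchronized code of block length $N$ with prefix $P$. -}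

module Defs where

open import Data.Nat as ℕ using (ℕ; zero; suc; _^_; _∸_; _≟_)
open import Data.Nat.Properties using (_!≢0)
open import Data.Nat using (_!)
open import Data.Integer using (+_)
open import Data.Rational as ℚ using (ℚ; _/_; 0ℚ)
open import Data.Fin using (Fin)
open import Data.List using (List; []; _∷_; map; concatMap; allFin; take; drop; length)
open import Data.List.Properties using (≡-dec)
open import Data.Fin.Properties using () renaming (_≟_ to _≟F_)
open import Data.Bool using (Bool; true; false; _∧_; _∨_; if_then_else_)
open import Relation.Nullary.Decidable using (⌊_⌋)
open import Data.Product using (Σ; _×_)

Word : ℕ → Set
Word q = List (Fin q)

allWords : (q n : ℕ) → List (Word q)
allWords q zero = [] ∷ []
allWords q (suc n) = concatMap (λ a → map (a ∷_) (allWords q n)) (allFin q)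

occursAt : {q : ℕ} → Word q → Word q → ℕ → Bool
occursAt {q} P w i = ⌊ ≡-dec _≟F_ (take (length P) (drop i w)) P ⌋

-- w is counted by G_P(N): for each 0-indexed position i ∈ {0,…,N}
-- (i.e. k = i+1 ∈ {1,…,N+1}), P occurs at i iff i = 0 or i = N.
goodUpTo : {q : ℕ} → Word q → Word q → (N : ℕ) → ℕ → Bool
goodUpTo P w N zero = isEq (occursAt P w 0) (true)
  where
  isEq : Bool → Bool → Bool
  isEq true true = true
  isEq false false = true
  isEq _ _ = false
goodUpTo P w N (suc i) =
  isEq (occursAt P w (suc i)) (⌊ suc i ≟ N ⌋) ∧ goodUpTo P w N i
  where
  isEq : Bool → Bool → Bool
  isEq true true = true
  isEq false false = true
  isEq _ _ = false

isPSync : {q : ℕ} → Word q → (N : ℕ) → Word q → Bool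
isPSync P N w = goodUpTo P w N N

count : {A : Set} → (A → Bool) → List A → ℕ
count f [] = 0
count f (x ∷ xs) = if f x then suc (count f xs) else count f xs

-- G_P(N): number of words of length N + p (p = |P|) over Fin q whose
-- occurrences of P among positions k = 1..N+1 are exactly k = 1 and k = N+1.
G : (q : ℕ) → Word q → ℕ → ℕ
G q P N = count (isPSync P N) (allWords q (N ℕ.+ length P))

expPartial : ℕ → ℕ → ℚ
expPartial zero m = ℚ.1ℚ
expPartial (suc K) m = expPartial K m ℚ.+ ((+ (m ^ suc K)) / (suc K !)) {{suc K !≢0}}

-- a ≤ e^m, where e^m = sup_K S K m: every rational below a is exceeded
-- by some partial sum.
infix 4 _≤exp_ _exp<_
_≤exp_ : ℕ → ℕ → Set
a ≤exp m = (r : ℚ) → r ℚ.< (+ a / 1) → Σ ℕ (λ K → r ℚ.< expPartial K m)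

-- e^m < b: some rational below b bounds all partial sums.
_exp<_ : ℕ → ℕ → Set
m exp< b = Σ ℚ (λ r → (r ℚ.< (+ b / 1)) × ((K : ℕ) → expPartial K m ℚ.≤ r))

-- The defining condition of p:  (ln q/(q-1)) q^p ≤ N < (ln q/(q-1)) q^(p+1),
-- equivalently (for q ≥ 2)  q^(q^p) ≤ e^((q-1)N) < q^(q^(p+1)).
pCondition : (q N p : ℕ) → Set
pCondition q N p = (q ^ (q ^ p) ≤exp ((q ∸ 1) ℕ.* N)) × (((q ∸ 1) ℕ.* N) exp< (q ^ (q ^ suc p)))

module Submission where

-- Write #free k, #final k, #ends k and #start k for the numbers of words v of length k such that P does
-- not occur in v, occurs in v ++ P only as the appended copy, occurs in v ++ P exactly at both ends, and
-- occurs in v only at the start; then #ends N ≤ G_P(N). Appending a letter gives #final (k+1) + #ends (k+1) = q #final k and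
-- #free (k+1) + #start (k+1) = q #free k with #start (k+1) ≤ #free (k+1−p), so #free grows at least
-- by the factor q (1 − q^(1−p)) ≥ 3/2. A word that is counted on the left but not on the right
-- overlaps P in a period r of P: either the shortest period π fits in the overlap, costing a factor
-- (2/3)^π, or r > p/2, costing (2/3)^r. This gives #free ≤ 4 #final and #final M ≤ 4 #ends (p + M),
-- hence q^M ≤ 2^(q^4) 16 #ends (p + M) as long as M < q^(p+2). The defining inequalities of p give
-- q^p ≤ 5 q n and N < q^(p+2), and q^n = q^(N−p) (q^p)² finishes the bound.

open import Defs
open import Data.Nat as ℕ using (ℕ; zero; suc; _+_; _*_; _^_; _∸_; _≤_; _<_; z≤n; s≤s; NonZero; >-nonZero; _!; ⌊_/2⌋; ⌈_/2⌉)
open import Data.Nat.Properties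
open import Data.Nat.Induction using (<-rec)
open import Data.Nat.ListAction using (sum)
open import Data.Nat.Tactic.RingSolver using (solve-∀)
open import Algebra.Properties.CommutativeSemigroup *-commutativeSemigroup using (x∙yz≈y∙xz)
open import Algebra.Properties.CommutativeSemigroup +-commutativeSemigroup using () renaming (interchange to +-interchange)
open import Data.Integer as ℤ using (+_)
import Data.Integer.Properties as ℤ
open import Data.Rational as ℚ using (ℚ; _/_; 0ℚ; toℚᵘ)
import Data.Rational.Properties as ℚ
open import Data.Rational.Unnormalised as ℚᵘ using (mkℚᵘ; *≤*; *<*; *≡*)
import Data.Rational.Unnormalised.Properties as ℚᵘ
open import Data.Fin as Fin using (Fin)
open import Data.Fin.Properties using () renaming (_≟_ to _≟F_)
open import Data.List as List using (List; []; _∷_; map; concatMap; allFin; take; drop; length; _++_; tabulate)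
open import Data.List.Properties using (≡-dec; map-tabulate; length-take; length-drop; ++-identityʳ; ++-assoc)
open import Data.Vec using (Vec; toList; []; _∷_)
open import Data.Vec.Properties using (length-toList)
open import Data.Maybe using (Maybe; just; nothing)
open import Data.Maybe.Properties using (just-injective)
open import Data.Bool using (Bool; true; false; _∧_; not; if_then_else_)
open import Data.Bool.Properties using (∧-conicalˡ; ∧-conicalʳ)
open import Data.Product using (Σ; ∃-syntax; _×_; _,_; proj₁; proj₂)
open import Data.Sum using (_⊎_; inj₁; inj₂)
open import Relation.Nullary.Decidable using (⌊_⌋; yes; no)
open import Relation.Nullary.Negation using (contradiction)
open import Relation.Binary.PropositionalEquality
open import Function using (_∘_; id)

-- Elementary inequalities

[m*n]^k≡m^k*n^k : ∀ m n k → (m * n) ^ k ≡ m ^ k * n ^ k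
[m*n]^k≡m^k*n^k m n zero = refl
[m*n]^k≡m^k*n^k m n (suc k) = begin
  m * n * (m * n) ^ k      ≡⟨ cong (m * n *_) ([m*n]^k≡m^k*n^k m n k) ⟩
  m * n * (m ^ k * n ^ k)  ≡⟨ swap m n (m ^ k) (n ^ k) ⟩
  m * m ^ k * (n * n ^ k)  ∎
  where
  open ≡-Reasoning
  swap : ∀ a b c d → a * b * (c * d) ≡ a * c * (b * d)
  swap = solve-∀

^-cancelʳ-≤ : ∀ q {a b} → 2 ≤ q → q ^ a ≤ q ^ b → a ≤ b
^-cancelʳ-≤ q 2≤q le = ≮⇒≥ (λ b<a → <⇒≱ (^-monoʳ-< q 2≤q b<a) le)

^-cancelʳ-< : ∀ q {a b} → 2 ≤ q → q ^ a < q ^ b → a < b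
^-cancelʳ-< q {a} {b} 2≤q lt = ≰⇒> (λ b≤a → <⇒≱ lt (^-monoʳ-≤ q {{>-nonZero (<-trans (s≤s z≤n) 2≤q)}} b≤a))

2*n≤2^n : ∀ n → 2 * n ≤ 2 ^ n
2*n≤2^n zero = z≤n
2*n≤2^n (suc zero) = ≤-refl
2*n≤2^n (suc (suc n)) = begin
  2 * suc (suc n)        ≡⟨ *-suc 2 (suc n) ⟩
  2 + 2 * suc n          ≤⟨ +-mono-≤ (*-monoʳ-≤ 2 (m^n>0 2 n)) (2*n≤2^n (suc n)) ⟩
  2 ^ suc n + 2 ^ suc n  ≡⟨ cong (λ x → 2 ^ suc n + x) (sym (+-identityʳ _)) ⟩
  2 ^ suc (suc n)        ∎
  where open ≤-Reasoning

m*n≤2^n : ∀ m n → 2 * m ≤ n → m * n ≤ 2 ^ n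
m*n≤2^n m n 2m≤n = begin
  m * n            ≤⟨ *-monoʳ-≤ m n≤2e ⟩
  m * (2 * e)      ≡⟨ x∙yz≈y∙xz m 2 e ⟩
  2 * (m * e)      ≡⟨ *-assoc 2 m e ⟨
  2 * m * e        ≤⟨ *-mono-≤ (2*n≤2^n m) (≤-trans (m≤n*m e 2) (2*n≤2^n e)) ⟩
  2 ^ m * 2 ^ e    ≡⟨ ^-distribˡ-+-* 2 m e ⟨
  2 ^ (m + e)      ≡⟨ cong (2 ^_) m+e≡n ⟩
  2 ^ n            ∎
  where
  open ≤-Reasoning
  e = n ∸ m
  m+e≡n : m + e ≡ n
  m+e≡n = m+[n∸m]≡n (≤-trans (m≤n*m m 2) 2m≤n)
  n≤2e : n ≤ 2 * e
  n≤2e = +-cancelˡ-≤ (2 * m) n (2 * e) (begin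
    2 * m + n        ≤⟨ +-monoˡ-≤ n 2m≤n ⟩
    n + n            ≡⟨ cong (_+ n) m+e≡n ⟨
    m + e + n        ≡⟨ cong (λ x → m + e + x) m+e≡n ⟨
    m + e + (m + e)  ≡⟨ double m e ⟩
    2 * m + 2 * e    ∎)
    where
    double : ∀ a b → a + b + (a + b) ≡ 2 * a + 2 * b
    double = solve-∀

24*r*2^r≤3^r : ∀ r → 16 ≤ r → 24 * r * 2 ^ r ≤ 3 ^ r
24*r*2^r≤3^r r 16≤r = subst (λ s → 24 * s * 2 ^ s ≤ 3 ^ s) (m+[n∸m]≡n 16≤r) (from16 (r ∸ 16))
  where
  open ≤-Reasoning
  from16 : ∀ d → 24 * (16 + d) * 2 ^ (16 + d) ≤ 3 ^ (16 + d)
  from16 zero = ≤ᵇ⇒≤ (24 * 16 * 2 ^ 16) (3 ^ 16) _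
  from16 (suc d) = subst (λ s → 24 * s * 2 ^ s ≤ 3 ^ s) (sym (+-suc 16 d)) (begin
    24 * suc s * (2 * 2 ^ s)    ≡⟨ rearrange s (2 ^ s) ⟩
    2 * suc s * (24 * 2 ^ s)    ≤⟨ *-monoˡ-≤ (24 * 2 ^ s) 2[1+s]≤3s ⟩
    3 * s * (24 * 2 ^ s)        ≡⟨ regroup s (2 ^ s) ⟩
    3 * (24 * s * 2 ^ s)        ≤⟨ *-monoʳ-≤ 3 (from16 d) ⟩
    3 * 3 ^ s                   ∎)
    where
    s = 16 + d
    rearrange : ∀ s x → 24 * suc s * (2 * x) ≡ 2 * suc s * (24 * x)
    rearrange = solve-∀
    regroup : ∀ s x → 3 * s * (24 * x) ≡ 3 * (24 * s * x)
    regroup = solve-∀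
    2[1+s]≤3s : 2 * suc s ≤ 3 * s
    2[1+s]≤3s = begin
      2 * suc s    ≡⟨ *-suc 2 s ⟩
      2 + 2 * s    ≤⟨ +-monoˡ-≤ (2 * s) (s≤s (s≤s (z≤n {14 + d}))) ⟩
      3 * s        ∎

[1+t]^[1+n]≤t^[1+n]+[1+n]*[1+t]^n : ∀ t n → suc t ^ suc n ≤ t ^ suc n + suc n * suc t ^ n
[1+t]^[1+n]≤t^[1+n]+[1+n]*[1+t]^n t zero = ≤-reflexive (base t)
  where
  base : ∀ t → suc t * 1 ≡ t * 1 + 1 * 1
  base = solve-∀
[1+t]^[1+n]≤t^[1+n]+[1+n]*[1+t]^n t (suc n) = begin
  suc t * suc t ^ suc n
    ≤⟨ *-monoʳ-≤ (suc t) ([1+t]^[1+n]≤t^[1+n]+[1+n]*[1+t]^n t n) ⟩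
  suc t * (t ^ suc n + suc n * suc t ^ n)
    ≡⟨ expand t (t ^ suc n) (suc n) (suc t ^ n) ⟩
  (t ^ suc n + t * t ^ suc n) + suc n * (suc t * suc t ^ n)
    ≤⟨ +-monoˡ-≤ (suc n * (suc t * suc t ^ n)) (+-monoˡ-≤ (t * t ^ suc n) (^-monoˡ-≤ (suc n) (n≤1+n t))) ⟩
  (suc t ^ suc n + t * t ^ suc n) + suc n * suc t ^ suc n
    ≡⟨ collect (suc t ^ suc n) (t * t ^ suc n) (suc n) ⟩
  t * t ^ suc n + suc (suc n) * suc t ^ suc n ∎
  where
  open ≤-Reasoning
  expand : ∀ t a k b → suc t * (a + k * b) ≡ (a + t * a) + k * (suc t * b)
  expand = solve-∀
  collect : ∀ a b c → (a + b) + c * a ≡ b + suc c * a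
  collect = solve-∀

[1+t]^n≤2*t^n : ∀ t n → 2 * n ≤ suc t → suc t ^ n ≤ 2 * t ^ n
[1+t]^n≤2*t^n t zero _ = s≤s z≤n
[1+t]^n≤2*t^n t (suc n) 2n≤1+t = +-cancelʳ-≤ (suc t ^ suc n) (suc t ^ suc n) (2 * t ^ suc n) (begin
  suc t ^ suc n + suc t ^ suc n
    ≤⟨ +-mono-≤ step step ⟩
  (t ^ suc n + suc n * suc t ^ n) + (t ^ suc n + suc n * suc t ^ n)
    ≡⟨ double (t ^ suc n) (suc n * suc t ^ n) ⟩
  2 * t ^ suc n + 2 * (suc n * suc t ^ n)
    ≤⟨ +-monoʳ-≤ (2 * t ^ suc n) 2[1+n][1+t]^n≤[1+t]^[1+n] ⟩
  2 * t ^ suc n + suc t ^ suc n ∎)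
  where
  open ≤-Reasoning
  step = [1+t]^[1+n]≤t^[1+n]+[1+n]*[1+t]^n t n
  double : ∀ a b → (a + b) + (a + b) ≡ 2 * a + 2 * b
  double = solve-∀
  2[1+n][1+t]^n≤[1+t]^[1+n] : 2 * (suc n * suc t ^ n) ≤ suc t ^ suc n
  2[1+n][1+t]^n≤[1+t]^[1+n] = ≤-trans (≤-reflexive (sym (*-assoc 2 (suc n) _))) (*-monoˡ-≤ (suc t ^ n) 2n≤1+t)

[1+t]^n≤2^c*t^n : ∀ t h c n → 2 * h ≤ suc t → n ≤ c * h → suc t ^ n ≤ 2 ^ c * t ^ n
[1+t]^n≤2^c*t^n t h zero zero _ _ = s≤s z≤n
[1+t]^n≤2^c*t^n t h (suc c) n 2h≤t n≤[1+c]h with n ℕ.≤? h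
... | yes n≤h = ≤-trans ([1+t]^n≤2*t^n t n (≤-trans (*-monoʳ-≤ 2 n≤h) 2h≤t))
                        (*-monoˡ-≤ (t ^ n) (*-monoʳ-≤ 2 (m^n>0 2 c)))
... | no n≰h = begin
  suc t ^ n                          ≡⟨ cong (suc t ^_) h+n′≡n ⟨
  suc t ^ (h + n′)                   ≡⟨ ^-distribˡ-+-* (suc t) h n′ ⟩
  suc t ^ h * suc t ^ n′             ≤⟨ *-mono-≤ ([1+t]^n≤2*t^n t h 2h≤t) ([1+t]^n≤2^c*t^n t h c n′ 2h≤t n′≤ch) ⟩
  (2 * t ^ h) * (2 ^ c * t ^ n′)     ≡⟨ swap (t ^ h) (2 ^ c) (t ^ n′) ⟩
  (2 * 2 ^ c) * (t ^ h * t ^ n′)     ≡⟨ cong (2 ^ suc c *_) (^-distribˡ-+-* t h n′) ⟨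
  2 ^ suc c * t ^ (h + n′)           ≡⟨ cong (λ k → 2 ^ suc c * t ^ k) h+n′≡n ⟩
  2 ^ suc c * t ^ n                  ∎
  where
  open ≤-Reasoning
  n′ = n ∸ h
  h+n′≡n : h + n′ ≡ n
  h+n′≡n = m+[n∸m]≡n (<⇒≤ (≰⇒> n≰h))
  n′≤ch : n′ ≤ c * h
  n′≤ch = ≤-trans (∸-monoˡ-≤ h n≤[1+c]h) (≤-reflexive (m+n∸m≡n h (c * h)))
  swap : ∀ a b c → (2 * a) * (b * c) ≡ (2 * b) * (a * c)
  swap = solve-∀

growth-iterate : (X : ℕ → ℕ) (α β a t : ℕ) → (∀ j → a ≤ j → j < a + t → α * X j ≤ β * X (suc j)) →
                 α ^ t * X a ≤ β ^ t * X (a + t)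
growth-iterate X α β a zero _ = ≤-reflexive (cong (λ k → 1 * X k) (sym (+-identityʳ a)))
growth-iterate X α β a (suc t) step = begin
  α * α ^ t * X a                ≡⟨ *-assoc α (α ^ t) (X a) ⟩
  α * (α ^ t * X a)              ≤⟨ *-monoʳ-≤ α (growth-iterate X α β a t (λ j a≤j j<a+t → step j a≤j (m<n⇒m<1+n′ j<a+t))) ⟩
  α * (β ^ t * X (a + t))        ≡⟨ x∙yz≈y∙xz α (β ^ t) (X (a + t)) ⟩
  β ^ t * (α * X (a + t))        ≤⟨ *-monoʳ-≤ (β ^ t) (step (a + t) (m≤m+n a t) (≤-reflexive (sym (+-suc a t)))) ⟩
  β ^ t * (β * X (suc (a + t)))  ≡⟨ x∙yz≈y∙xz (β ^ t) β _ ⟩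
  β * (β ^ t * X (suc (a + t)))  ≡⟨ *-assoc β (β ^ t) _ ⟨
  β * β ^ t * X (suc (a + t))    ≡⟨ cong (λ k → β * β ^ t * X k) (+-suc a t) ⟨
  β * β ^ t * X (a + suc t)      ∎
  where
  open ≤-Reasoning
  m<n⇒m<1+n′ : ∀ {j} → j < a + t → j < a + suc t
  m<n⇒m<1+n′ lt = ≤-trans lt (+-monoʳ-≤ a (n≤1+n t))

growth-weaken : ∀ {a b} .{{_ : NonZero b}} (i j X Y : ℕ) → a ≤ b → j ≤ i →
                b ^ i * X ≤ a ^ i * Y → b ^ j * X ≤ a ^ j * Y
growth-weaken {a} {b} i j X Y a≤b j≤i le = *-cancelˡ-≤ (b ^ (i ∸ j)) {{m^n≢0 b (i ∸ j)}} (begin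
  b ^ (i ∸ j) * (b ^ j * X)  ≡⟨ *-assoc (b ^ (i ∸ j)) (b ^ j) X ⟨
  b ^ (i ∸ j) * b ^ j * X    ≡⟨ cong (_* X) (split b) ⟨
  b ^ i * X                  ≤⟨ le ⟩
  a ^ i * Y                  ≡⟨ cong (_* Y) (split a) ⟩
  a ^ (i ∸ j) * a ^ j * Y    ≤⟨ *-monoˡ-≤ Y (*-monoˡ-≤ (a ^ j) (^-monoˡ-≤ (i ∸ j) a≤b)) ⟩
  b ^ (i ∸ j) * a ^ j * Y    ≡⟨ *-assoc (b ^ (i ∸ j)) (a ^ j) Y ⟩
  b ^ (i ∸ j) * (a ^ j * Y)  ∎)
  where
  open ≤-Reasoning
  split : ∀ c → c ^ i ≡ c ^ (i ∸ j) * c ^ j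
  split c = trans (cong (c ^_) (sym (m∸n+n≡m j≤i))) (^-distribˡ-+-* c (i ∸ j) j)

absorb : ∀ {X F A S a} → X ≤ F + A + S → A ≤ a → 3 * a ≤ 2 * X → 12 * S ≤ X → X ≤ 4 * F
absorb {X} {F} {A} {S} {a} X≤F+A+S A≤a 3a≤2X 12S≤X =
  *-cancelˡ-≤ 3 (+-cancelʳ-≤ (9 * X) (3 * X) (3 * (4 * F)) (begin
    3 * X + 9 * X                   ≡⟨ e₁ X ⟩
    12 * X                          ≤⟨ *-monoʳ-≤ 12 X≤F+A+S ⟩
    12 * (F + A + S)                ≡⟨ e₂ F A S ⟩
    12 * F + 4 * (3 * A) + 12 * S   ≤⟨ +-mono-≤ (+-monoʳ-≤ (12 * F) (*-monoʳ-≤ 4 (≤-trans (*-monoʳ-≤ 3 A≤a) 3a≤2X))) 12S≤X ⟩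
    12 * F + 4 * (2 * X) + X        ≡⟨ e₃ F X ⟩
    3 * (4 * F) + 9 * X             ∎))
  where
  open ≤-Reasoning
  e₁ : ∀ X → 3 * X + 9 * X ≡ 12 * X
  e₁ = solve-∀
  e₂ : ∀ F A S → 12 * (F + A + S) ≡ 12 * F + 4 * (3 * A) + 12 * S
  e₂ = solve-∀
  e₃ : ∀ F X → 12 * F + 4 * (2 * X) + X ≡ 3 * (4 * F) + 9 * X
  e₃ = solve-∀

sumBelow : ℕ → (ℕ → ℕ) → ℕ
sumBelow zero f = 0
sumBelow (suc n) f = f n + sumBelow n f

sumBelow-≥ : ∀ {n r} (f : ℕ → ℕ) → r < n → f r ≤ sumBelow n f
sumBelow-≥ {suc n} {r} f r<1+n with m≤n⇒m<n∨m≡n r<1+n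
... | inj₂ refl = m≤m+n (f r) _
... | inj₁ r<n = ≤-trans (sumBelow-≥ f (≤-pred r<n)) (m≤n+m _ (f n))

sumBelow-mono : ∀ n {f g : ℕ → ℕ} → (∀ r → r < n → f r ≤ g r) → sumBelow n f ≤ sumBelow n g
sumBelow-mono zero le = z≤n
sumBelow-mono (suc n) le = +-mono-≤ (le n ≤-refl) (sumBelow-mono n (λ r r<n → le r (≤-trans r<n (n≤1+n n))))

*-sumBelow≤ : ∀ n c B (f : ℕ → ℕ) → (∀ r → r < n → c * f r ≤ B) → c * sumBelow n f ≤ n * B
*-sumBelow≤ zero c B f _ = ≤-reflexive (*-zeroʳ c)
*-sumBelow≤ (suc n) c B f le = ≤-trans (≤-reflexive (*-distribˡ-+ c (f n) _))
                                      (+-mono-≤ (le n ≤-refl) (*-sumBelow≤ n c B f (λ r r<n → le r (≤-trans r<n (n≤1+n n)))))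

-- Fractions and the exponential series

toℚᵘ-/ : ∀ a b .{{_ : NonZero b}} → toℚᵘ ((+ a) / b) ℚᵘ.≃ mkℚᵘ (+ a) (ℕ.pred b)
toℚᵘ-/ a (suc b) = ℚ.toℚᵘ-fromℚᵘ (mkℚᵘ (+ a) b)

*≤*⇒/≤/ : ∀ a b c d .{{_ : NonZero b}} .{{_ : NonZero d}} → a * d ≤ c * b → (+ a) / b ℚ.≤ (+ c) / d
*≤*⇒/≤/ a (suc b) c (suc d) le = ℚ.toℚᵘ-cancel-≤
  (ℚᵘ.≤-respˡ-≃ (ℚᵘ.≃-sym (toℚᵘ-/ a (suc b))) (ℚᵘ.≤-respʳ-≃ (ℚᵘ.≃-sym (toℚᵘ-/ c (suc d)))
    (*≤* (subst₂ ℤ._≤_ (ℤ.pos-* a (suc d)) (ℤ.pos-* c (suc b)) (ℤ.+≤+ le)))))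

/</⇒*<* : ∀ a b c d .{{_ : NonZero b}} .{{_ : NonZero d}} → (+ a) / b ℚ.< (+ c) / d → a * d < c * b
/</⇒*<* a (suc b) c (suc d) lt with ℚᵘ.<-respˡ-≃ (toℚᵘ-/ a (suc b)) (ℚᵘ.<-respʳ-≃ (toℚᵘ-/ c (suc d)) (ℚ.toℚᵘ-mono-< lt))
... | *<* lt′ = ℤ.drop‿+<+ (subst₂ ℤ._<_ (sym (ℤ.pos-* a (suc d))) (sym (ℤ.pos-* c (suc b))) lt′)

*<*⇒/</ : ∀ a b c d .{{_ : NonZero b}} .{{_ : NonZero d}} → a * d < c * b → (+ a) / b ℚ.< (+ c) / d
*<*⇒/</ a (suc b) c (suc d) lt = ℚ.toℚᵘ-cancel-<
  (ℚᵘ.<-respˡ-≃ (ℚᵘ.≃-sym (toℚᵘ-/ a (suc b))) (ℚᵘ.<-respʳ-≃ (ℚᵘ.≃-sym (toℚᵘ-/ c (suc d)))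
    (*<* (subst₂ ℤ._<_ (ℤ.pos-* a (suc d)) (ℤ.pos-* c (suc b)) (ℤ.+<+ lt)))))

*≡*⇒/≡/ : ∀ a b c d .{{_ : NonZero b}} .{{_ : NonZero d}} → a * d ≡ c * b → (+ a) / b ≡ (+ c) / d
*≡*⇒/≡/ a b c d eq = ℚ.≤-antisym (*≤*⇒/≤/ a b c d (≤-reflexive eq)) (*≤*⇒/≤/ c d a b (≤-reflexive (sym eq)))

/+/ : ∀ a b c d .{{_ : NonZero b}} .{{_ : NonZero d}} →
      (+ a) / b ℚ.+ (+ c) / d ≡ ((+ (a * d + c * b)) / (b * d)) {{m*n≢0 b d}}
/+/ a (suc b) c (suc d) = ℚ.toℚᵘ-injective (ℚᵘ.≃-trans (ℚ.toℚᵘ-homo-+ ((+ a) / suc b) ((+ c) / suc d))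
  (ℚᵘ.≃-trans (ℚᵘ.+-cong (toℚᵘ-/ a (suc b)) (toℚᵘ-/ c (suc d)))
    (ℚᵘ.≃-trans (*≡* (cong (ℤ._* + (suc b * suc d)) numerator))
      (ℚᵘ.≃-sym (toℚᵘ-/ (a * suc d + c * suc b) (suc b * suc d))))))
  where
  numerator : + a ℤ.* + suc d ℤ.+ + c ℤ.* + suc b ≡ + (a * suc d + c * suc b)
  numerator = trans (cong₂ ℤ._+_ (sym (ℤ.pos-* a (suc d))) (sym (ℤ.pos-* c (suc b)))) (sym (ℤ.pos-+ (a * suc d) (c * suc b)))

/*/ : ∀ a b c d .{{_ : NonZero b}} .{{_ : NonZero d}} →
      ((+ a) / b) ℚ.* ((+ c) / d) ≡ ((+ (a * c)) / (b * d)) {{m*n≢0 b d}}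
/*/ a (suc b) c (suc d) = ℚ.toℚᵘ-injective (ℚᵘ.≃-trans (ℚ.toℚᵘ-homo-* ((+ a) / suc b) ((+ c) / suc d))
  (ℚᵘ.≃-trans (ℚᵘ.*-cong (toℚᵘ-/ a (suc b)) (toℚᵘ-/ c (suc d)))
    (ℚᵘ.≃-trans (*≡* (cong (ℤ._* + (suc b * suc d)) (sym (ℤ.pos-* a c))))
      (ℚᵘ.≃-sym (toℚᵘ-/ (a * c) (suc b * suc d))))))

n!≤n^n : ∀ n → n ! ≤ n ^ n
n!≤n^n zero = ≤-refl
n!≤n^n (suc n) = *-monoʳ-≤ (suc n) (≤-trans (n!≤n^n n) (^-monoˡ-≤ n (n≤1+n n)))

[m+d]!≤m!*[m+d]^d : ∀ m d → (m + d) ! ≤ m ! * (m + d) ^ d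
[m+d]!≤m!*[m+d]^d m zero = ≤-reflexive (trans (cong _! (+-identityʳ m)) (sym (*-identityʳ (m !))))
[m+d]!≤m!*[m+d]^d m (suc d) = begin
  (m + suc d) !                          ≡⟨ cong _! (+-suc m d) ⟩
  suc (m + d) * (m + d) !                ≤⟨ *-monoʳ-≤ (suc (m + d)) ([m+d]!≤m!*[m+d]^d m d) ⟩
  suc (m + d) * (m ! * (m + d) ^ d)      ≤⟨ *-monoʳ-≤ (suc (m + d)) (*-monoʳ-≤ (m !) (^-monoˡ-≤ d (n≤1+n (m + d)))) ⟩
  suc (m + d) * (m ! * suc (m + d) ^ d)  ≡⟨ x∙yz≈y∙xz (suc (m + d)) (m !) _ ⟩
  m ! * suc (m + d) ^ suc d              ≡⟨ cong (λ z → m ! * z ^ suc d) (+-suc m d) ⟨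
  m ! * (m + suc d) ^ suc d              ∎
  where open ≤-Reasoning

m!*m^d≤[m+d]! : ∀ m d → m ! * m ^ d ≤ (m + d) !
m!*m^d≤[m+d]! m zero = ≤-reflexive (trans (*-identityʳ (m !)) (cong _! (sym (+-identityʳ m))))
m!*m^d≤[m+d]! m (suc d) = begin
  m ! * (m * m ^ d)          ≡⟨ x∙yz≈y∙xz (m !) m (m ^ d) ⟩
  m * (m ! * m ^ d)          ≤⟨ *-mono-≤ (≤-trans (m≤m+n m d) (n≤1+n (m + d))) (m!*m^d≤[m+d]! m d) ⟩
  suc (m + d) * (m + d) !    ≡⟨ cong _! (+-suc m d) ⟨
  (m + suc d) !              ∎
  where open ≤-Reasoning

n^k*n!≤n^n*k! : ∀ n k → n ^ k * n ! ≤ n ^ n * k !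
n^k*n!≤n^n*k! n k with ≤-total k n
... | inj₁ k≤n = begin
  n ^ k * n !                  ≡⟨ cong (λ z → n ^ k * z !) k+d≡n ⟨
  n ^ k * (k + d) !            ≤⟨ *-monoʳ-≤ (n ^ k) ([m+d]!≤m!*[m+d]^d k d) ⟩
  n ^ k * (k ! * (k + d) ^ d)  ≡⟨ cong (λ z → n ^ k * (k ! * z ^ d)) k+d≡n ⟩
  n ^ k * (k ! * n ^ d)        ≡⟨ swap (n ^ k) (k !) (n ^ d) ⟩
  n ^ k * n ^ d * k !          ≡⟨ cong (_* k !) (trans (sym (^-distribˡ-+-* n k d)) (cong (n ^_) k+d≡n)) ⟩
  n ^ n * k !                  ∎
  where
  open ≤-Reasoning
  d = n ∸ k
  k+d≡n = m+[n∸m]≡n k≤n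
  swap : ∀ x y z → x * (y * z) ≡ x * z * y
  swap = solve-∀
... | inj₂ n≤k = begin
  n ^ k * n !                  ≡⟨ cong (λ z → n ^ z * n !) n+d≡k ⟨
  n ^ (n + d) * n !            ≡⟨ cong (_* n !) (^-distribˡ-+-* n n d) ⟩
  n ^ n * n ^ d * n !          ≡⟨ swap (n ^ n) (n ^ d) (n !) ⟩
  n ^ n * (n ! * n ^ d)        ≤⟨ *-monoʳ-≤ (n ^ n) (m!*m^d≤[m+d]! n d) ⟩
  n ^ n * (n + d) !            ≡⟨ cong (λ z → n ^ n * z !) n+d≡k ⟩
  n ^ n * k !                  ∎
  where
  open ≤-Reasoning
  d = k ∸ n
  n+d≡k = m+[n∸m]≡n n≤k
  swap : ∀ x y z → x * y * z ≡ x * (z * y)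
  swap = solve-∀

2*⌊n/2⌋≤n : ∀ n → 2 * ⌊ n /2⌋ ≤ n
2*⌊n/2⌋≤n zero = z≤n
2*⌊n/2⌋≤n (suc zero) = z≤n
2*⌊n/2⌋≤n (suc (suc n)) = ≤-trans (≤-reflexive (*-suc 2 ⌊ n /2⌋)) (s≤s (s≤s (2*⌊n/2⌋≤n n)))

[1+n]^n≤4*n^n : ∀ n → suc n ^ n ≤ 4 * n ^ n
[1+n]^n≤4*n^n n = begin
  suc n ^ n                         ≡⟨ cong (suc n ^_) (⌊n/2⌋+⌈n/2⌉≡n n) ⟨
  suc n ^ (a + b)                   ≡⟨ ^-distribˡ-+-* (suc n) a b ⟩
  suc n ^ a * suc n ^ b             ≤⟨ *-mono-≤ ([1+t]^n≤2*t^n n a (≤-trans (2*⌊n/2⌋≤n n) (n≤1+n n))) ([1+t]^n≤2*t^n n b (2*⌊n/2⌋≤n (suc n))) ⟩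
  (2 * n ^ a) * (2 * n ^ b)         ≡⟨ regroup (n ^ a) (n ^ b) ⟩
  4 * (n ^ a * n ^ b)               ≡⟨ cong (4 *_) (trans (sym (^-distribˡ-+-* n a b)) (cong (n ^_) (⌊n/2⌋+⌈n/2⌉≡n n))) ⟩
  4 * n ^ n                         ∎
  where
  open ≤-Reasoning
  a = ⌊ n /2⌋
  b = ⌈ n /2⌉
  regroup : ∀ x y → (2 * x) * (2 * y) ≡ 4 * (x * y)
  regroup = solve-∀

n^n≤4^n*n! : ∀ n → n ^ n ≤ 4 ^ n * n !
n^n≤4^n*n! zero = ≤-refl
n^n≤4^n*n! (suc n) = begin
  suc n * suc n ^ n               ≤⟨ *-monoʳ-≤ (suc n) ([1+n]^n≤4*n^n n) ⟩
  suc n * (4 * n ^ n)             ≤⟨ *-monoʳ-≤ (suc n) (*-monoʳ-≤ 4 (n^n≤4^n*n! n)) ⟩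
  suc n * (4 * (4 ^ n * n !))     ≡⟨ regroup (suc n) (4 ^ n) (n !) ⟩
  4 * 4 ^ n * (suc n * n !)       ∎
  where
  open ≤-Reasoning
  regroup : ∀ s x f → s * (4 * (x * f)) ≡ 4 * x * (s * f)
  regroup = solve-∀

n^k≤4^n*k! : ∀ n k → n ^ k ≤ 4 ^ n * k !
n^k≤4^n*k! n k = *-cancelʳ-≤ (n ^ k) (4 ^ n * k !) (n !) {{n !≢0}} (begin
  n ^ k * n !             ≤⟨ n^k*n!≤n^n*k! n k ⟩
  n ^ n * k !             ≤⟨ *-monoˡ-≤ (k !) (n^n≤4^n*n! n) ⟩
  4 ^ n * n ! * k !       ≡⟨ swap (4 ^ n) (n !) (k !) ⟩
  4 ^ n * k ! * n !       ∎)
  where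
  open ≤-Reasoning
  swap : ∀ x y z → x * y * z ≡ x * z * y
  swap = solve-∀

2^k*m^k≤16^m*k! : ∀ m k → 2 ^ k * m ^ k ≤ 16 ^ m * k !
2^k*m^k≤16^m*k! m k = begin
  2 ^ k * m ^ k        ≡⟨ [m*n]^k≡m^k*n^k 2 m k ⟨
  (2 * m) ^ k          ≤⟨ n^k≤4^n*k! (2 * m) k ⟩
  4 ^ (2 * m) * k !    ≡⟨ cong (_* k !) (^-*-assoc 4 2 m) ⟨
  16 ^ m * k !         ∎
  where open ≤-Reasoning

expNumer : ℕ → ℕ → ℕ
expNumer zero m = 1
expNumer (suc K) m = suc K * expNumer K m + m ^ suc K

expPartial≡expNumer/K! : ∀ K m → expPartial K m ≡ ((+ expNumer K m) / (K !)) {{K !≢0}}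
expPartial≡expNumer/K! zero m = refl
expPartial≡expNumer/K! (suc K) m = begin
  expPartial K m ℚ.+ ((+ (m ^ suc K)) / (suc K !)) {{suc K !≢0}}
    ≡⟨ cong (ℚ._+ ((+ (m ^ suc K)) / (suc K !)) {{suc K !≢0}}) (expPartial≡expNumer/K! K m) ⟩
  ((+ expNumer K m) / (K !)) {{K !≢0}} ℚ.+ ((+ (m ^ suc K)) / (suc K !)) {{suc K !≢0}}
    ≡⟨ /+/ (expNumer K m) (K !) (m ^ suc K) (suc K !) {{K !≢0}} {{suc K !≢0}} ⟩
  ((+ (expNumer K m * suc K ! + m ^ suc K * K !)) / (K ! * suc K !)) {{m*n≢0 (K !) (suc K !) {{K !≢0}} {{suc K !≢0}}}}
    ≡⟨ *≡*⇒/≡/ (expNumer K m * suc K ! + m ^ suc K * K !) (K ! * suc K !) (expNumer (suc K) m) (suc K !)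
                {{m*n≢0 (K !) (suc K !) {{K !≢0}} {{suc K !≢0}}}} {{suc K !≢0}} (cross (expNumer K m) (m ^ suc K) K (K !)) ⟩
  ((+ expNumer (suc K) m) / (suc K !)) {{suc K !≢0}} ∎
  where
  open ≡-Reasoning
  cross : ∀ e x k f → (e * (suc k * f) + x * f) * (suc k * f) ≡ (suc k * e + x) * (f * (suc k * f))
  cross = solve-∀

m^K≤expNumer : ∀ m K → m ^ K ≤ expNumer K m
m^K≤expNumer m zero = ≤-refl
m^K≤expNumer m (suc K) = m≤n+m (m ^ suc K) (suc K * expNumer K m)

-- Σ_{k ≤ K} m^k/k! ≤ Σ_{k ≤ K} 16^m/2^k, in the form that survives induction.
expNumer-geometric : ∀ m K → 2 ^ K * expNumer K m + 16 ^ m * K ! ≤ 2 ^ suc K * (16 ^ m * K !)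
expNumer-geometric m zero = ≤-trans (+-monoˡ-≤ (16 ^ m * 1) (≤-trans (m^n>0 16 m) (m≤m*n (16 ^ m) 1)))
                                    (≤-reflexive (double (16 ^ m)))
  where
  double : ∀ s → s * 1 + s * 1 ≡ 2 * 1 * (s * 1)
  double = solve-∀
expNumer-geometric m (suc K) = begin
  (2 * P) * (suc K * e + x) + s * (suc K * f)              ≡⟨ expand P e x s f K ⟩
  2 * suc K * (P * e) + (2 * P) * x + suc K * (s * f)      ≤⟨ +-monoˡ-≤ (suc K * (s * f)) (+-monoʳ-≤ (2 * suc K * (P * e)) (2^k*m^k≤16^m*k! m (suc K))) ⟩
  2 * suc K * (P * e) + s * (suc K * f) + suc K * (s * f)  ≡⟨ collect P e s f K ⟩
  2 * suc K * (P * e + s * f)                              ≤⟨ *-monoʳ-≤ (2 * suc K) (expNumer-geometric m K) ⟩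
  2 * suc K * ((2 * P) * (s * f))                          ≡⟨ regroup P s f K ⟩
  2 * (2 * P) * (s * (suc K * f))                          ∎
  where
  open ≤-Reasoning
  P = 2 ^ K
  e = expNumer K m
  x = m ^ suc K
  s = 16 ^ m
  f = K !
  expand : ∀ P e x s f K → (2 * P) * (suc K * e + x) + s * (suc K * f) ≡ 2 * suc K * (P * e) + (2 * P) * x + suc K * (s * f)
  expand = solve-∀
  collect : ∀ P e s f K → 2 * suc K * (P * e) + s * (suc K * f) + suc K * (s * f) ≡ 2 * suc K * (P * e + s * f)
  collect = solve-∀
  regroup : ∀ P s f K → 2 * suc K * ((2 * P) * (s * f)) ≡ 2 * (2 * P) * (s * (suc K * f))
  regroup = solve-∀

expPartial≤2*16^m : ∀ K m → expPartial K m ℚ.≤ (+ (2 * 16 ^ m)) / 1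
expPartial≤2*16^m K m = subst (ℚ._≤ (+ (2 * 16 ^ m)) / 1) (sym (expPartial≡expNumer/K! K m))
  (*≤*⇒/≤/ (expNumer K m) (K !) (2 * 16 ^ m) 1 {{K !≢0}} (begin
    expNumer K m * 1           ≡⟨ *-identityʳ _ ⟩
    expNumer K m               ≤⟨ *-cancelˡ-≤ (2 ^ K) {{m^n≢0 2 K}} (≤-trans (m≤m+n _ _) (≤-trans (expNumer-geometric m K) (≤-reflexive (regroup (2 ^ K) (16 ^ m) (K !))))) ⟩
    2 * 16 ^ m * K !           ∎))
  where
  open ≤-Reasoning
  regroup : ∀ P s f → 2 * P * (s * f) ≡ P * (2 * s * f)
  regroup = solve-∀

≤exp⇒≤ : ∀ {a m b} → a ≤exp m → (∀ K → expPartial K m ℚ.≤ (+ b) / 1) → a ≤ b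
≤exp⇒≤ {a} {m} {b} a≤eᵐ bounded = ≮⇒≥ λ b<a →
  let (K , b<partial) = a≤eᵐ ((+ b) / 1) (*<*⇒/</ b 1 a 1 (*-monoˡ-< 1 b<a))
  in ℚ.<-irrefl refl (ℚ.<-≤-trans b<partial (bounded K))

-- With M = (q − 1) N: q^(q^p) ≤ e^M ≤ 2 · 16^M = 2^(4M+1) ≤ q^(4M+1).
q^p≤1+4[q-1]N : ∀ q N p → 2 ≤ q → q ^ (q ^ p) ≤exp ((q ∸ 1) * N) → q ^ p ≤ suc (4 * ((q ∸ 1) * N))
q^p≤1+4[q-1]N q N p 2≤q lower = ^-cancelʳ-≤ q 2≤q (begin
  q ^ (q ^ p)         ≤⟨ ≤exp⇒≤ lower (λ K → expPartial≤2*16^m K M) ⟩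
  2 * 16 ^ M          ≡⟨ cong (2 *_) (^-*-assoc 2 4 M) ⟩
  2 ^ suc (4 * M)     ≤⟨ ^-monoˡ-≤ (suc (4 * M)) 2≤q ⟩
  q ^ suc (4 * M)     ∎)
  where
  open ≤-Reasoning
  M = (q ∸ 1) * N

-- With M = (q − 1) N and L = q^(p+1): M^L / L! < e^M < q^L, so M^L < q^L L! ≤ (q L)^L.
N<q^[2+p] : ∀ q N p → 2 ≤ q → ((q ∸ 1) * N) exp< (q ^ (q ^ suc p)) → N < q ^ suc (suc p)
N<q^[2+p] q N p 2≤q (r , r<B , bounded) = ≤-<-trans N≤M M<qL
  where
  M = (q ∸ 1) * N
  L = q ^ suc p
  B = q ^ L
  partial<B : ((+ expNumer L M) / (L !)) {{L !≢0}} ℚ.< (+ B) / 1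
  partial<B = subst (ℚ._< (+ B) / 1) (expPartial≡expNumer/K! L M) (ℚ.≤-<-trans (bounded L) r<B)
  M^L<[qL]^L : M ^ L < (q * L) ^ L
  M^L<[qL]^L = begin-strict
    M ^ L               ≤⟨ m^K≤expNumer M L ⟩
    expNumer L M        ≡⟨ *-identityʳ _ ⟨
    expNumer L M * 1    <⟨ /</⇒*<* (expNumer L M) (L !) B 1 {{L !≢0}} partial<B ⟩
    B * L !             ≤⟨ *-monoʳ-≤ B (n!≤n^n L) ⟩
    q ^ L * L ^ L       ≡⟨ [m*n]^k≡m^k*n^k q L L ⟨
    (q * L) ^ L         ∎
    where open ≤-Reasoning
  M<qL : M < q * L
  M<qL = ≰⇒> (λ qL≤M → <⇒≱ M^L<[qL]^L (^-monoˡ-≤ L qL≤M))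
  N≤M : N ≤ M
  N≤M = ≤-trans (≤-reflexive (sym (*-identityˡ N))) (*-monoˡ-≤ N (≤-trans (≤-reflexive (sym (m+n∸m≡n 1 1))) (∸-monoˡ-≤ 1 2≤q)))

-- Sums over words

⟦_⟧ : Bool → ℕ
⟦ true ⟧ = 1
⟦ false ⟧ = 0

if-≤ : ∀ b x → (if b then x else 0) ≤ x
if-≤ true x = ≤-refl
if-≤ false x = z≤n

if-mono : ∀ b {x y} → x ≤ y → (if b then x else 0) ≤ (if b then y else 0)
if-mono true le = le
if-mono false _ = z≤n

⟦⟧-cover : ∀ {b c : Bool} {x n} (f : ℕ → ℕ) →
           (b ≡ true → c ≡ false → 1 ≤ x ⊎ ∃[ r ] r < n × 1 ≤ f r) → ⟦ b ⟧ ≤ ⟦ c ⟧ + x + sumBelow n f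
⟦⟧-cover {false} f _ = z≤n
⟦⟧-cover {true} {true} {x} {n} f _ = ≤-trans (m≤m+n 1 x) (m≤m+n (1 + x) (sumBelow n f))
⟦⟧-cover {true} {false} {x} {n} f cover with cover refl refl
... | inj₁ 1≤x = ≤-trans 1≤x (m≤m+n x _)
... | inj₂ (r , r<n , 1≤fr) = ≤-trans 1≤fr (≤-trans (sumBelow-≥ f r<n) (m≤n+m _ x))

if-true-1 : ∀ {b c} → b ≡ true → c ≡ true → 1 ≤ (if b then ⟦ c ⟧ else 0)
if-true-1 refl refl = ≤-refl

if-true-≤ : ∀ {b x} → b ≡ true → 1 ≤ x → 1 ≤ (if b then x else 0)
if-true-≤ refl le = le

sumFin : ∀ {n} → (Fin n → ℕ) → ℕ
sumFin {zero} f = 0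
sumFin {suc n} f = f Fin.zero + sumFin (f ∘ Fin.suc)

sum-map-allFin : ∀ {n} (f : Fin n → ℕ) → sum (map f (allFin n)) ≡ sumFin f
sum-map-allFin {zero} f = refl
sum-map-allFin {suc n} f = cong (_+_ (f Fin.zero)) (begin
  sum (map f (tabulate Fin.suc))  ≡⟨ cong sum (map-tabulate Fin.suc f) ⟩
  sum (tabulate (f ∘ Fin.suc))    ≡⟨ cong sum (map-tabulate id (f ∘ Fin.suc)) ⟨
  sum (map (f ∘ Fin.suc) (allFin n)) ≡⟨ sum-map-allFin (f ∘ Fin.suc) ⟩
  sumFin (f ∘ Fin.suc)            ∎)
  where open ≡-Reasoning

sumFin-mono : ∀ {n} {f g : Fin n → ℕ} → (∀ a → f a ≤ g a) → sumFin f ≤ sumFin g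
sumFin-mono {zero} le = z≤n
sumFin-mono {suc n} le = +-mono-≤ (le Fin.zero) (sumFin-mono (le ∘ Fin.suc))

sumFin-cong : ∀ {n} {f g : Fin n → ℕ} → (∀ a → f a ≡ g a) → sumFin f ≡ sumFin g
sumFin-cong {zero} eq = refl
sumFin-cong {suc n} eq = cong₂ _+_ (eq Fin.zero) (sumFin-cong (eq ∘ Fin.suc))

sumFin-+ : ∀ {n} (f g : Fin n → ℕ) → sumFin (λ a → f a + g a) ≡ sumFin f + sumFin g
sumFin-+ {zero} f g = refl
sumFin-+ {suc n} f g = trans (cong (λ x → f Fin.zero + g Fin.zero + x) (sumFin-+ (f ∘ Fin.suc) (g ∘ Fin.suc)))
                             (+-interchange (f Fin.zero) (g Fin.zero) (sumFin (f ∘ Fin.suc)) (sumFin (g ∘ Fin.suc)))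

sumFin-const : ∀ {n} c → sumFin {n} (λ _ → c) ≡ n * c
sumFin-const {zero} c = refl
sumFin-const {suc n} c = cong (_+_ c) (sumFin-const {n} c)

sumFin-select : ∀ {n} (c : Fin n) (f : Fin n → ℕ) → sumFin (λ a → if ⌊ c ≟F a ⌋ then f a else 0) ≡ f c
sumFin-select {suc n} Fin.zero f = trans (cong (_+_ (f Fin.zero)) (trans (sumFin-const {n} 0) (*-zeroʳ n))) (+-identityʳ _)
sumFin-select {suc n} (Fin.suc c) f = trans (sumFin-cong unshift) (sumFin-select c (f ∘ Fin.suc))
  where
  unshift : ∀ a → (if ⌊ Fin.suc c ≟F Fin.suc a ⌋ then f (Fin.suc a) else 0) ≡ (if ⌊ c ≟F a ⌋ then f (Fin.suc a) else 0)
  unshift a with c ≟F a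
  ... | yes refl = refl
  ... | no _ = refl

module _ {A : Set} where

  at : List A → ℕ → Maybe A
  at [] k = nothing
  at (a ∷ w) zero = just a
  at (a ∷ w) (suc k) = at w k

  at-drop : ∀ i k (w : List A) → at (drop i w) k ≡ at w (i + k)
  at-drop zero k w = refl
  at-drop (suc i) k [] = refl
  at-drop (suc i) k (a ∷ w) = at-drop i k w

  at-take : ∀ i k (w : List A) → k < i → at (take i w) k ≡ at w k
  at-take (suc i) zero [] _ = refl
  at-take (suc i) zero (a ∷ w) _ = refl
  at-take (suc i) (suc k) [] _ = refl
  at-take (suc i) (suc k) (a ∷ w) (s≤s k<i) = at-take i k w k<i

  at-++ˡ : ∀ (x y : List A) k → k < length x → at (x ++ y) k ≡ at x k
  at-++ˡ (a ∷ x) y zero _ = refl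
  at-++ˡ (a ∷ x) y (suc k) (s≤s k<x) = at-++ˡ x y k k<x

  at-++ʳ : ∀ (x y : List A) k → at (x ++ y) (length x + k) ≡ at y k
  at-++ʳ [] y k = refl
  at-++ʳ (a ∷ x) y k = at-++ʳ x y k

  at-ext : ∀ (x y : List A) → length x ≡ length y → (∀ k → k < length x → at x k ≡ at y k) → x ≡ y
  at-ext [] [] _ _ = refl
  at-ext (a ∷ x) (b ∷ y) eq pointwise =
    cong₂ _∷_ (just-injective (pointwise 0 (s≤s z≤n))) (at-ext x y (suc-injective eq) (λ k k<x → pointwise (suc k) (s≤s k<x)))

  drop-length-++ : ∀ (x y : List A) → drop (length x) (x ++ y) ≡ y
  drop-length-++ [] y = refl
  drop-length-++ (a ∷ x) y = drop-length-++ x y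

module Words (q : ℕ) where

  sumWords : ℕ → (Word q → ℕ) → ℕ
  sumWords zero f = f []
  sumWords (suc n) f = sumFin (λ a → sumWords n (λ v → f (a ∷ v)))

  count-++ : (f : Word q → Bool) (xs ys : List (Word q)) → count f (xs ++ ys) ≡ count f xs + count f ys
  count-++ f [] ys = refl
  count-++ f (x ∷ xs) ys with f x
  ... | true = cong suc (count-++ f xs ys)
  ... | false = count-++ f xs ys

  count-map : (f : Word q → Bool) (g : Word q → Word q) (xs : List (Word q)) → count f (map g xs) ≡ count (f ∘ g) xs
  count-map f g [] = refl
  count-map f g (x ∷ xs) with f (g x)
  ... | true = cong suc (count-map f g xs)
  ... | false = count-map f g xs

  count-concatMap : ∀ {B : Set} (f : Word q → Bool) (h : B → List (Word q)) (xs : List B) →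
                    count f (concatMap h xs) ≡ sum (map (count f ∘ h) xs)
  count-concatMap f h [] = refl
  count-concatMap f h (x ∷ xs) = trans (count-++ f (h x) (concatMap h xs)) (cong (_+_ (count f (h x))) (count-concatMap f h xs))

  count-allWords : ∀ n (f : Word q → Bool) → count f (allWords q n) ≡ sumWords n (λ v → ⟦ f v ⟧)
  count-allWords zero f with f []
  ... | true = refl
  ... | false = refl
  count-allWords (suc n) f = begin
    count f (allWords q (suc n))                                 ≡⟨ count-concatMap f _ (allFin q) ⟩
    sum (map (λ a → count f (map (a ∷_) (allWords q n))) (allFin q)) ≡⟨ sum-map-allFin (λ a → count f (map (a ∷_) (allWords q n))) ⟩
    sumFin (λ a → count f (map (a ∷_) (allWords q n)))           ≡⟨ sumFin-cong (λ a → count-map f (a ∷_) (allWords q n)) ⟩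
    sumFin (λ a → count (λ v → f (a ∷ v)) (allWords q n))        ≡⟨ sumFin-cong (λ a → count-allWords n (λ v → f (a ∷ v))) ⟩
    sumWords (suc n) (λ v → ⟦ f v ⟧)                             ∎
    where open ≡-Reasoning

  sumWords-mono : ∀ n {f g : Word q → ℕ} → (∀ v → length v ≡ n → f v ≤ g v) → sumWords n f ≤ sumWords n g
  sumWords-mono zero le = le [] refl
  sumWords-mono (suc n) le = sumFin-mono (λ a → sumWords-mono n (λ v eq → le (a ∷ v) (cong suc eq)))

  sumWords-cong : ∀ n {f g : Word q → ℕ} → (∀ v → length v ≡ n → f v ≡ g v) → sumWords n f ≡ sumWords n g
  sumWords-cong n eq = ≤-antisym (sumWords-mono n (λ v l → ≤-reflexive (eq v l)))
                                 (sumWords-mono n (λ v l → ≤-reflexive (sym (eq v l))))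

  sumWords-+ : ∀ n (f g : Word q → ℕ) → sumWords n (λ v → f v + g v) ≡ sumWords n f + sumWords n g
  sumWords-+ zero f g = refl
  sumWords-+ (suc n) f g = trans (sumFin-cong (λ a → sumWords-+ n (λ v → f (a ∷ v)) (λ v → g (a ∷ v)))) (sumFin-+ (λ a → sumWords n (λ v → f (a ∷ v))) (λ a → sumWords n (λ v → g (a ∷ v))))

  sumWords-const : ∀ n c → sumWords n (λ _ → c) ≡ q ^ n * c
  sumWords-const zero c = sym (+-identityʳ c)
  sumWords-const (suc n) c = begin
    sumFin {q} (λ _ → sumWords n (λ _ → c))  ≡⟨ sumFin-cong {q} (λ _ → sumWords-const n c) ⟩
    sumFin {q} (λ _ → q ^ n * c)             ≡⟨ sumFin-const {q} (q ^ n * c) ⟩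
    q * (q ^ n * c)                      ≡⟨ *-assoc q (q ^ n) c ⟨
    q ^ suc n * c                        ∎
    where open ≡-Reasoning

  sumWords-zero : ∀ n → sumWords n (λ _ → 0) ≡ 0
  sumWords-zero n = trans (sumWords-const n 0) (*-zeroʳ (q ^ n))

  sumWords-sumBelow : ∀ k n (f : ℕ → Word q → ℕ) → sumWords k (λ v → sumBelow n (λ r → f r v)) ≡ sumBelow n (λ r → sumWords k (f r))
  sumWords-sumBelow k zero f = sumWords-zero k
  sumWords-sumBelow k (suc n) f = trans (sumWords-+ k (f n) (λ v → sumBelow n (λ r → f r v)))
                                        (cong (_+_ (sumWords k (f n))) (sumWords-sumBelow k n f))

  sumWords-if : ∀ k b (f : Word q → ℕ) → sumWords k (λ v → if b then f v else 0) ≡ (if b then sumWords k f else 0)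
  sumWords-if k true f = refl
  sumWords-if k false f = sumWords-zero k

  isPrefix : Word q → Word q → Bool
  isPrefix [] w = true
  isPrefix (c ∷ s) [] = false
  isPrefix (c ∷ s) (a ∷ w) = ⌊ c ≟F a ⌋ ∧ isPrefix s w

  isSuffix : Word q → Word q → Bool
  isSuffix t v = isPrefix t (drop (length v ∸ length t) v)

  isPrefix-sound : ∀ s w → isPrefix s w ≡ true → ∀ k → k < length s → at s k ≡ at w k
  isPrefix-sound (c ∷ s) (a ∷ w) eq k k<s with c ≟F a
  isPrefix-sound (c ∷ s) (a ∷ w) eq zero _ | yes refl = refl
  isPrefix-sound (c ∷ s) (a ∷ w) eq (suc k) (s≤s k<s) | yes refl = isPrefix-sound s w eq k k<s

  isPrefix-complete : ∀ s w → (∀ k → k < length s → at s k ≡ at w k) → isPrefix s w ≡ true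
  isPrefix-complete [] w _ = refl
  isPrefix-complete (c ∷ s) [] pointwise with pointwise 0 (s≤s z≤n)
  ... | ()
  isPrefix-complete (c ∷ s) (a ∷ w) pointwise with c ≟F a
  ... | yes refl = isPrefix-complete s w (λ k k<s → pointwise (suc k) (s≤s k<s))
  ... | no c≢a = contradiction (just-injective (pointwise 0 (s≤s z≤n))) c≢a

  isPrefix-length : ∀ s w → isPrefix s w ≡ true → length s ≤ length w
  isPrefix-length [] w eq = z≤n
  isPrefix-length (c ∷ s) (a ∷ w) eq with c ≟F a
  ... | yes _ = s≤s (isPrefix-length s w eq)

  isPrefix-refl : ∀ s → isPrefix s s ≡ true
  isPrefix-refl s = isPrefix-complete s s (λ _ _ → refl)

  isPrefix-trans : ∀ s t w → isPrefix s t ≡ true → isPrefix t w ≡ true → isPrefix s w ≡ true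
  isPrefix-trans s t w s≼t t≼w = isPrefix-complete s w (λ k k<s →
    trans (isPrefix-sound s t s≼t k k<s) (isPrefix-sound t w t≼w k (≤-trans k<s (isPrefix-length s t s≼t))))

  isPrefix-++ : ∀ s x y → isPrefix s x ≡ true → isPrefix s (x ++ y) ≡ true
  isPrefix-++ s x y s≼x = isPrefix-complete s (x ++ y) (λ k k<s →
    trans (isPrefix-sound s x s≼x k k<s) (sym (at-++ˡ x y k (≤-trans k<s (isPrefix-length s x s≼x)))))

  isPrefix-++⁻ : ∀ s x y → isPrefix s (x ++ y) ≡ true → length s ≤ length x → isPrefix s x ≡ true
  isPrefix-++⁻ s x y s≼xy s≤x = isPrefix-complete s x (λ k k<s →
    trans (isPrefix-sound s (x ++ y) s≼xy k k<s) (at-++ˡ x y k (≤-trans k<s s≤x)))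

  take-≟-isPrefix : ∀ P x → ⌊ ≡-dec _≟F_ (take (length P) x) P ⌋ ≡ isPrefix P x
  take-≟-isPrefix P x with ≡-dec _≟F_ (take (length P) x) P
  ... | yes eq = sym (isPrefix-complete P x (λ k k<P → trans (cong (λ z → at z k) (sym eq)) (at-take (length P) k x k<P)))
  ... | no neq with isPrefix P x in P≼x
  ...   | false = refl
  ...   | true = contradiction (at-ext (take (length P) x) P len (λ k k<take →
                   let k<P = subst (k <_) len k<take in
                   trans (at-take (length P) k x k<P) (sym (isPrefix-sound P x P≼x k k<P)))) neq
    where
    len : length (take (length P) x) ≡ length P
    len = trans (length-take (length P) x) (m≤n⇒m⊓n≡m (isPrefix-length P x P≼x))

  isSuffix-sound : ∀ t v → isSuffix t v ≡ true →
                   length t ≤ length v × (∀ k → k < length t → at t k ≡ at v ((length v ∸ length t) + k))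
  isSuffix-sound t v t≽v = t≤v , λ k k<t → trans (isPrefix-sound t _ t≽v k k<t) (at-drop (length v ∸ length t) k v)
    where
    t≤v : length t ≤ length v
    t≤v = ≤-trans (isPrefix-length t _ t≽v) (≤-trans (≤-reflexive (length-drop (length v ∸ length t) v)) (m∸n≤m (length v) (length v ∸ length t)))

  isSuffix-complete : ∀ t v → (∀ k → k < length t → at t k ≡ at v ((length v ∸ length t) + k)) → isSuffix t v ≡ true
  isSuffix-complete t v pointwise = isPrefix-complete t _ (λ k k<t → trans (pointwise k k<t) (sym (at-drop (length v ∸ length t) k v)))

  isSuffix-trans : ∀ t u v → isSuffix t u ≡ true → isSuffix u v ≡ true → isSuffix t v ≡ true
  isSuffix-trans t u v t≽u u≽v = isSuffix-complete t v pointwise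
    where
    t≤u = proj₁ (isSuffix-sound t u t≽u)
    u≤v = proj₁ (isSuffix-sound u v u≽v)
    offset : ∀ k → (length v ∸ length u) + ((length u ∸ length t) + k) ≡ (length v ∸ length t) + k
    offset k = trans (sym (+-assoc (length v ∸ length u) _ k))
                     (cong (_+ k) (trans (sym (+-∸-assoc (length v ∸ length u) t≤u)) (cong (_∸ length t) (m∸n+n≡m u≤v))))
    pointwise : ∀ k → k < length t → at t k ≡ at v ((length v ∸ length t) + k)
    pointwise k k<t = trans (proj₂ (isSuffix-sound t u t≽u) k k<t)
      (trans (proj₂ (isSuffix-sound u v u≽v) _ (subst (_< length u) (+-comm k _)
                                                  (subst (k + (length u ∸ length t) <_) (m+[n∸m]≡n t≤u) (+-monoˡ-< _ k<t))))
             (cong (at v) (offset k)))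

  isSuffix-∷ : ∀ t v a → isSuffix t v ≡ true → isSuffix t (a ∷ v) ≡ true
  isSuffix-∷ t v a t≽v = isSuffix-complete t (a ∷ v) pointwise
    where
    pointwise : ∀ k → k < length t → at t k ≡ at (a ∷ v) ((suc (length v) ∸ length t) + k)
    pointwise k k<t rewrite +-∸-assoc 1 (proj₁ (isSuffix-sound t v t≽v)) = proj₂ (isSuffix-sound t v t≽v) k k<t

  sumWords-prefix : ∀ s n (f : Word q → ℕ) →
                    sumWords (length s + n) (λ w → if isPrefix s w then f w else 0) ≡ sumWords n (λ v → f (s ++ v))
  sumWords-prefix [] n f = refl
  sumWords-prefix (c ∷ s) n f = begin
    sumFin (λ a → sumWords (length s + n) (λ w → if ⌊ c ≟F a ⌋ ∧ isPrefix s w then f (a ∷ w) else 0))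
      ≡⟨ sumFin-cong first-letter ⟩
    sumFin (λ a → if ⌊ c ≟F a ⌋ then sumWords (length s + n) (λ w → if isPrefix s w then f (a ∷ w) else 0) else 0)
      ≡⟨ sumFin-select c (λ a → sumWords (length s + n) (λ w → if isPrefix s w then f (a ∷ w) else 0)) ⟩
    sumWords (length s + n) (λ w → if isPrefix s w then f (c ∷ w) else 0)
      ≡⟨ sumWords-prefix s n (λ w → f (c ∷ w)) ⟩
    sumWords n (λ v → f (c ∷ s ++ v)) ∎
    where
    open ≡-Reasoning
    first-letter : ∀ a → sumWords (length s + n) (λ w → if ⌊ c ≟F a ⌋ ∧ isPrefix s w then f (a ∷ w) else 0)
                       ≡ (if ⌊ c ≟F a ⌋ then sumWords (length s + n) (λ w → if isPrefix s w then f (a ∷ w) else 0) else 0)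
    first-letter a with c ≟F a
    ... | yes _ = refl
    ... | no _ = sumWords-zero (length s + n)

  sumWords-suffix : ∀ t n (f : Word q → ℕ) →
                    sumWords (n + length t) (λ v → if isSuffix t v then f v else 0) ≡ sumWords n (λ u → f (u ++ t))
  sumWords-suffix t zero f = begin
    sumWords (length t) (λ v → if isSuffix t v then f v else 0)      ≡⟨ sumWords-cong (length t) whole ⟩
    sumWords (length t) (λ v → if isPrefix t v then f v else 0)      ≡⟨ cong (λ m → sumWords m (λ v → if isPrefix t v then f v else 0)) (+-identityʳ (length t)) ⟨
    sumWords (length t + 0) (λ v → if isPrefix t v then f v else 0)  ≡⟨ sumWords-prefix t 0 f ⟩
    f (t ++ [])                                                       ≡⟨ cong f (++-identityʳ t) ⟩
    f t                                                               ∎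
    where
    open ≡-Reasoning
    whole : ∀ v → length v ≡ length t → (if isSuffix t v then f v else 0) ≡ (if isPrefix t v then f v else 0)
    whole v eq rewrite eq | n∸n≡0 (length t) = refl
  sumWords-suffix t (suc n) f = sumFin-cong (λ a → trans (sumWords-cong (n + length t) (longer a)) (sumWords-suffix t n (λ w → f (a ∷ w))))
    where
    longer : ∀ a v → length v ≡ n + length t → (if isSuffix t (a ∷ v) then f (a ∷ v) else 0) ≡ (if isSuffix t v then f (a ∷ v) else 0)
    longer a v eq rewrite eq | +-∸-assoc 1 {n + length t} {length t} (m≤n+m (length t) n) | m+n∸n≡m n (length t) = refl

-- Words counted by their occurrences of P

module Pattern (q : ℕ) (c₀ : Fin q) (P₀ : Word q) where
  open Words q

  P : Word q
  P = c₀ ∷ P₀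

  p : ℕ
  p = length P

  free? : Word q → Bool
  free? [] = true
  free? (a ∷ w) = not (isPrefix P (a ∷ w)) ∧ free? w

  final? : Word q → Bool
  final? [] = true
  final? (a ∷ v) = not (isPrefix P (a ∷ v ++ P)) ∧ final? v

  ends? : Word q → Bool
  ends? [] = false
  ends? (a ∷ v) = isPrefix P (a ∷ v ++ P) ∧ final? v

  start? : Word q → Bool
  start? [] = false
  start? (a ∷ w) = isPrefix P (a ∷ w) ∧ free? w

  #free #final #ends #start : ℕ → ℕ
  #free k = sumWords k (λ v → ⟦ free? v ⟧)
  #final k = sumWords k (λ v → ⟦ final? v ⟧)
  #ends k = sumWords k (λ v → ⟦ ends? v ⟧)
  #start k = sumWords k (λ v → ⟦ start? v ⟧)

  not-true : ∀ {b} → not b ≡ true → b ≡ true → ∀ {A : Set} → A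
  not-true {true} () _

  free-++ˡ : ∀ u v → free? (u ++ v) ≡ true → free? u ≡ true
  free-++ˡ [] v eq = refl
  free-++ˡ (a ∷ u) v eq = cong₂ _∧_ head-free (free-++ˡ u v (∧-conicalʳ _ _ eq))
    where
    head-free : not (isPrefix P (a ∷ u)) ≡ true
    head-free with isPrefix P (a ∷ u) in P≼au
    ... | false = refl
    ... | true = not-true (∧-conicalˡ _ _ eq) (isPrefix-++ P (a ∷ u) v P≼au)

  free-drop : ∀ j w → free? w ≡ true → free? (drop j w) ≡ true
  free-drop zero w eq = eq
  free-drop (suc j) [] eq = refl
  free-drop (suc j) (a ∷ w) eq = free-drop j w (∧-conicalʳ _ _ eq)

  final-++ : ∀ u v → final? (u ++ v) ≡ true → final? v ≡ true
  final-++ [] v eq = eq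
  final-++ (a ∷ u) v eq = final-++ u v (∧-conicalʳ _ _ eq)

  final-drop : ∀ j w → final? w ≡ true → final? (drop j w) ≡ true
  final-drop zero w eq = eq
  final-drop (suc j) [] eq = refl
  final-drop (suc j) (a ∷ w) eq = final-drop j w (∧-conicalʳ _ _ eq)

  final⇒free : ∀ v → final? v ≡ true → free? v ≡ true
  final⇒free [] eq = refl
  final⇒free (a ∷ v) eq = cong₂ _∧_ head-free (final⇒free v (∧-conicalʳ _ _ eq))
    where
    head-free : not (isPrefix P (a ∷ v)) ≡ true
    head-free with isPrefix P (a ∷ v) in P≼av
    ... | false = refl
    ... | true = not-true (∧-conicalˡ _ _ eq) (isPrefix-++ P (a ∷ v) P P≼av)

  ⟦not∧⟧+⟦∧⟧ : ∀ b c → ⟦ not b ∧ c ⟧ + ⟦ b ∧ c ⟧ ≡ ⟦ c ⟧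
  ⟦not∧⟧+⟦∧⟧ true true = refl
  ⟦not∧⟧+⟦∧⟧ true false = refl
  ⟦not∧⟧+⟦∧⟧ false true = refl
  ⟦not∧⟧+⟦∧⟧ false false = refl

  #final-step : ∀ k → #final (suc k) + #ends (suc k) ≡ q * #final k
  #final-step k = begin
    #final (suc k) + #ends (suc k)                   ≡⟨ sumWords-+ (suc k) (λ v → ⟦ final? v ⟧) (λ v → ⟦ ends? v ⟧) ⟨
    sumFin (λ a → sumWords k (λ v → ⟦ final? (a ∷ v) ⟧ + ⟦ ends? (a ∷ v) ⟧))
      ≡⟨ sumFin-cong (λ a → sumWords-cong k (λ v _ → ⟦not∧⟧+⟦∧⟧ (isPrefix P (a ∷ v ++ P)) (final? v))) ⟩
    sumFin {q} (λ _ → #final k)                      ≡⟨ sumFin-const {q} (#final k) ⟩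
    q * #final k                                     ∎
    where open ≡-Reasoning

  #free-step : ∀ k → #free (suc k) + #start (suc k) ≡ q * #free k
  #free-step k = begin
    #free (suc k) + #start (suc k)                   ≡⟨ sumWords-+ (suc k) (λ v → ⟦ free? v ⟧) (λ v → ⟦ start? v ⟧) ⟨
    sumFin (λ a → sumWords k (λ v → ⟦ free? (a ∷ v) ⟧ + ⟦ start? (a ∷ v) ⟧))
      ≡⟨ sumFin-cong (λ a → sumWords-cong k (λ v _ → ⟦not∧⟧+⟦∧⟧ (isPrefix P (a ∷ v)) (free? v))) ⟩
    sumFin {q} (λ _ → #free k)                       ≡⟨ sumFin-const {q} (#free k) ⟩
    q * #free k                                      ∎
    where open ≡-Reasoning

  #final≤#free : ∀ n → #final n ≤ #free n
  #final≤#free n = sumWords-mono n pointwise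
    where
    pointwise : ∀ v → length v ≡ n → ⟦ final? v ⟧ ≤ ⟦ free? v ⟧
    pointwise v _ with final? v in eq
    ... | false = z≤n
    ... | true rewrite final⇒free v eq = ≤-refl

  #start-short : ∀ k → k < p → #start k ≡ 0
  #start-short k k<p = trans (sumWords-cong k pointwise) (sumWords-zero k)
    where
    pointwise : ∀ w → length w ≡ k → ⟦ start? w ⟧ ≡ 0
    pointwise [] _ = refl
    pointwise (a ∷ w) eq with isPrefix P (a ∷ w) in P≼aw
    ... | false = refl
    ... | true = contradiction (subst (p ≤_) eq (isPrefix-length P (a ∷ w) P≼aw)) (<⇒≱ k<p)

  #start≤#free : ∀ n → #start (p + n) ≤ #free n
  #start≤#free n = begin
    #start (p + n)                                                   ≤⟨ sumWords-mono (p + n) pointwise ⟩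
    sumWords (p + n) (λ w → if isPrefix P w then ⟦ free? (drop p w) ⟧ else 0) ≡⟨ sumWords-prefix P n (λ w → ⟦ free? (drop p w) ⟧) ⟩
    sumWords n (λ v → ⟦ free? (drop p (P ++ v)) ⟧)                   ≡⟨ sumWords-cong n (λ v _ → cong (λ z → ⟦ free? z ⟧) (drop-length-++ P v)) ⟩
    #free n                                                          ∎
    where
    open ≤-Reasoning
    pointwise : ∀ w → length w ≡ p + n → ⟦ start? w ⟧ ≤ (if isPrefix P w then ⟦ free? (drop p w) ⟧ else 0)
    pointwise [] _ = z≤n
    pointwise (a ∷ w) _ with isPrefix P (a ∷ w) | free? w in eq
    ... | false | _ = z≤n
    ... | true | false = z≤n
    ... | true | true rewrite free-drop (length P₀) w eq = ≤-refl

  #ends≤#final : ∀ n → #ends (p + n) ≤ #final n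
  #ends≤#final n = begin
    #ends (p + n)                                                    ≤⟨ sumWords-mono (p + n) pointwise ⟩
    sumWords (p + n) (λ w → if isPrefix P w then ⟦ final? (drop p w) ⟧ else 0) ≡⟨ sumWords-prefix P n (λ w → ⟦ final? (drop p w) ⟧) ⟩
    sumWords n (λ v → ⟦ final? (drop p (P ++ v)) ⟧)                  ≡⟨ sumWords-cong n (λ v _ → cong (λ z → ⟦ final? z ⟧) (drop-length-++ P v)) ⟩
    #final n                                                         ∎
    where
    open ≤-Reasoning
    pointwise : ∀ w → length w ≡ p + n → ⟦ ends? w ⟧ ≤ (if isPrefix P w then ⟦ final? (drop p w) ⟧ else 0)
    pointwise [] _ = z≤n
    pointwise (a ∷ v) eq with isPrefix P (a ∷ v ++ P) in P≼avP | final? v in fin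
    ... | false | _ = z≤n
    ... | true | false = z≤n
    ... | true | true rewrite isPrefix-++⁻ P (a ∷ v) P P≼avP (subst (p ≤_) (sym eq) (m≤m+n p n))
                            | final-drop (length P₀) v fin = ≤-refl

-- Periods of P

module Periods (q : ℕ) (c₀ : Fin q) (P₀ : Word q) where
  open Words q
  open Pattern q c₀ P₀

  length-take-P : ∀ {r} → r ≤ p → length (take r P) ≡ r
  length-take-P {r} r≤p = trans (length-take r P) (m≤n⇒m⊓n≡m r≤p)

  length-drop-P : ∀ {r} → r ≤ p → length (drop (p ∸ r) P) ≡ r
  length-drop-P {r} r≤p = trans (length-drop (p ∸ r) P) (m∸[m∸n]≡n r≤p)

  Period : ℕ → Set
  Period d = ∀ k → d + k < p → at P (d + k) ≡ at P k

  isPeriod : ℕ → Bool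
  isPeriod d = isPrefix (drop d P) P

  isPeriod-sound : ∀ d → isPeriod d ≡ true → Period d
  isPeriod-sound d eq k d+k<p = trans (sym (at-drop d k P)) (isPrefix-sound (drop d P) P eq k k<p∸d)
    where
    k<p∸d : k < length (drop d P)
    k<p∸d = subst (k <_) (sym (length-drop d P)) (subst (_< p ∸ d) (m+n∸m≡n d k) (∸-monoˡ-< d+k<p (m≤m+n d k)))

  isPeriod-complete : ∀ d → Period d → isPeriod d ≡ true
  isPeriod-complete d period = isPrefix-complete (drop d P) P (λ k k<p∸d → trans (at-drop d k P) (period k (d+k<p k k<p∸d)))
    where
    d+k<p : ∀ k → k < length (drop d P) → d + k < p
    d+k<p k k<p∸d with d ℕ.≤? p
    ... | yes d≤p = subst (d + k <_) (m+[n∸m]≡n d≤p) (+-monoʳ-< d (subst (k <_) (length-drop d P) k<p∸d))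
    ... | no d≰p = contradiction (subst (k <_) (trans (length-drop d P) (m≤n⇒m∸n≡0 (≰⇒≥ d≰p))) k<p∸d) (λ ())

  -- The easy half of the Fine–Wilf theorem.
  Period-∸ : ∀ {e d} → Period e → Period d → e ≤ d → d + e ≤ p → Period (d ∸ e)
  Period-∸ {e} {d} pe pd e≤d d+e≤p k d∸e+k<p with d + k ℕ.<? p
  ... | yes d+k<p = trans (sym (pe (d ∸ e + k) (subst (_< p) (sym shift) d+k<p))) (trans (cong (at P) shift) (pd k d+k<p))
    where
    shift : e + (d ∸ e + k) ≡ d + k
    shift = trans (sym (+-assoc e (d ∸ e) k)) (cong (_+ k) (m+[n∸m]≡n e≤d))
  ... | no d+k≮p = begin
    at P (d ∸ e + k)   ≡⟨ cong (at P) shift ⟩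
    at P (d + k′)      ≡⟨ pd k′ (subst (_< p) shift d∸e+k<p) ⟩
    at P k′            ≡⟨ pe k′ (subst (_< p) (sym e+k′≡k) (≤-trans (s≤s (m≤n+m k (d ∸ e))) d∸e+k<p)) ⟨
    at P (e + k′)      ≡⟨ cong (at P) e+k′≡k ⟩
    at P k             ∎
    where
    open ≡-Reasoning
    e≤k : e ≤ k
    e≤k = +-cancelˡ-≤ d e k (≤-trans d+e≤p (≮⇒≥ d+k≮p))
    k′ = k ∸ e
    e+k′≡k : e + k′ ≡ k
    e+k′≡k = m+[n∸m]≡n e≤k
    shift : d ∸ e + k ≡ d + k′
    shift = trans (cong (λ x → d ∸ e + x) (sym e+k′≡k)) (trans (sym (+-assoc (d ∸ e) e k′)) (cong (_+ k′) (m∸n+n≡m e≤d)))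

  take-period-suffix : ∀ {e d} → Period e → Period d → e ≤ d → d + e ≤ p → isSuffix (take e P) (take d P) ≡ true
  take-period-suffix {e} {d} pe pd e≤d d+e≤p = isSuffix-complete (take e P) (take d P) pointwise
    where
    d≤p = ≤-trans (m≤m+n d e) d+e≤p
    e≤p = ≤-trans e≤d d≤p
    pointwise : ∀ k → k < length (take e P) → at (take e P) k ≡ at (take d P) ((length (take d P) ∸ length (take e P)) + k)
    pointwise k k<e rewrite length-take-P e≤p | length-take-P d≤p =
      trans (at-take e k P k<e) (sym (trans (at-take d (d ∸ e + k) P idx<d) (Period-∸ pe pd e≤d d+e≤p k (≤-trans idx<d d≤p))))
      where
      idx<d : d ∸ e + k < d
      idx<d = subst (d ∸ e + k <_) (m∸n+n≡m e≤d) (+-monoʳ-< (d ∸ e) k<e)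

  drop-period-prefix : ∀ {e d} → Period e → Period d → e ≤ d → d + e ≤ p → isPrefix (drop (p ∸ e) P) (drop (p ∸ d) P) ≡ true
  drop-period-prefix {e} {d} pe pd e≤d d+e≤p = isPrefix-complete (drop (p ∸ e) P) (drop (p ∸ d) P) pointwise
    where
    d≤p = ≤-trans (m≤m+n d e) d+e≤p
    e≤p = ≤-trans e≤d d≤p
    pointwise : ∀ k → k < length (drop (p ∸ e) P) → at (drop (p ∸ e) P) k ≡ at (drop (p ∸ d) P) k
    pointwise k k<e = begin
      at (drop (p ∸ e) P) k          ≡⟨ at-drop (p ∸ e) k P ⟩
      at P (p ∸ e + k)               ≡⟨ cong (at P) shift ⟩
      at P (d ∸ e + (p ∸ d + k))     ≡⟨ Period-∸ pe pd e≤d d+e≤p (p ∸ d + k) (subst (_< p) shift idx<p) ⟩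
      at P (p ∸ d + k)               ≡⟨ at-drop (p ∸ d) k P ⟨
      at (drop (p ∸ d) P) k          ∎
      where
      open ≡-Reasoning
      shift : p ∸ e + k ≡ d ∸ e + (p ∸ d + k)
      shift = trans (cong (_+ k) (sym (trans (+-comm (d ∸ e) (p ∸ d)) (trans (sym (+-∸-assoc (p ∸ d) e≤d)) (cong (_∸ e) (m∸n+n≡m d≤p))))))
                    (+-assoc (d ∸ e) (p ∸ d) k)
      idx<p : p ∸ e + k < p
      idx<p = subst (p ∸ e + k <_) (m∸n+n≡m e≤p) (+-monoʳ-< (p ∸ e) (subst (k <_) (length-drop-P e≤p) k<e))

  firstPeriod : ℕ → ℕ → ℕ
  firstPeriod lo zero = lo
  firstPeriod lo (suc n) = if isPeriod lo then lo else firstPeriod (suc lo) n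

  firstPeriod-spec : ∀ lo n d → lo ≤ d → d < lo + n → Period d →
                     firstPeriod lo n ≤ d × Period (firstPeriod lo n) × lo ≤ firstPeriod lo n
  firstPeriod-spec lo zero d lo≤d d<lo+0 _ = contradiction (subst (_≤ d) (sym (+-identityʳ lo)) lo≤d) (<⇒≱ d<lo+0)
  firstPeriod-spec lo (suc n) d lo≤d d<lo+n pd with isPeriod lo in lo-period
  ... | true = lo≤d , isPeriod-sound lo lo-period , ≤-refl
  ... | false with m≤n⇒m<n∨m≡n lo≤d
  ...   | inj₂ refl = contradiction (trans (sym (isPeriod-complete d pd)) lo-period) (λ ())
  ...   | inj₁ lo<d = let (≤d , period , 1+lo≤) = firstPeriod-spec (suc lo) n d lo<d (subst (d <_) (+-suc lo n) d<lo+n) pd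
                      in ≤d , period , ≤-trans (n≤1+n lo) 1+lo≤

  π : ℕ
  π = firstPeriod 1 p

  Period-p : Period p
  Period-p k p+k<p = contradiction p+k<p (m+n≮m p k)

  π-minimal : ∀ {d} → 1 ≤ d → d ≤ p → Period d → π ≤ d
  π-minimal 1≤d d≤p pd = proj₁ (firstPeriod-spec 1 p _ 1≤d (s≤s d≤p) pd)

  π-period : Period π
  π-period = proj₁ (proj₂ (firstPeriod-spec 1 p p (s≤s z≤n) ≤-refl Period-p))

  1≤π : 1 ≤ π
  1≤π = proj₂ (proj₂ (firstPeriod-spec 1 p p (s≤s z≤n) ≤-refl Period-p))

  π≤p : π ≤ p
  π≤p = π-minimal (s≤s z≤n) ≤-refl Period-p

  not∧-false : ∀ b {c} → not b ∧ c ≡ false → c ≡ true → b ≡ true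
  not∧-false true _ _ = refl
  not∧-false false () refl

  not∧-true : ∀ b {c} → not b ∧ c ≡ true → b ≡ false
  not∧-true false _ = refl

  free-not-final⇒period-suffix : ∀ v → free? v ≡ true → final? v ≡ false →
    ∃[ r ] 1 ≤ r × r < p × Period r × isSuffix (take r P) v ≡ true
  free-not-final⇒period-suffix (a ∷ v) free fail with final? v in final-v
  ... | false = let (r , 1≤r , r<p , pr , suffix) = free-not-final⇒period-suffix v (∧-conicalʳ _ _ free) final-v
                in r , 1≤r , r<p , pr , isSuffix-∷ (take r P) v a suffix
  ... | true = r , s≤s z≤n , r<p , period , isSuffix-complete (take r P) x pointwise
    where
    x = a ∷ v
    r = length x
    P≼xP : isPrefix P (x ++ P) ≡ true
    P≼xP = not∧-false (isPrefix P (x ++ P)) fail refl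
    r<p : r < p
    r<p = ≰⇒> (λ p≤r → contradiction (trans (sym (isPrefix-++⁻ P x P P≼xP p≤r)) (not∧-true (isPrefix P x) free)) (λ ()))
    |take| : length (take r P) ≡ r
    |take| = length-take-P (<⇒≤ r<p)
    pointwise : ∀ k → k < length (take r P) → at (take r P) k ≡ at x ((length x ∸ length (take r P)) + k)
    pointwise k k<take = begin
      at (take r P) k                           ≡⟨ at-take r k P k<r ⟩
      at P k                                    ≡⟨ isPrefix-sound P (x ++ P) P≼xP k (<-trans k<r r<p) ⟩
      at (x ++ P) k                             ≡⟨ at-++ˡ x P k k<r ⟩
      at x k                                    ≡⟨ cong (at x) offset ⟨
      at x ((r ∸ length (take r P)) + k)        ∎
      where
      open ≡-Reasoning
      k<r = subst (k <_) |take| k<take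
      offset : (r ∸ length (take r P)) + k ≡ k
      offset = trans (cong (λ z → r ∸ z + k) |take|) (cong (_+ k) (n∸n≡0 r))
    period : Period r
    period k r+k<p = trans (isPrefix-sound P (x ++ P) P≼xP (r + k) r+k<p) (at-++ʳ x P k)

  final-shift : ∀ u v → final? (u ++ v) ≡ false → final? v ≡ true →
                ∃[ j ] j < length u × isPrefix P (drop j u ++ v ++ P) ≡ true
  final-shift [] v fail final-v = contradiction (trans (sym final-v) fail) (λ ())
  final-shift (a ∷ u) v fail final-v with final? (u ++ v) in final-uv
  ... | false = let (j , j<u , occurs) = final-shift u v final-uv final-v in suc j , s≤s j<u , occurs
  ... | true = 0 , s≤s z≤n , subst (λ z → isPrefix P (a ∷ z) ≡ true) (++-assoc u v P)
                                   (not∧-false (isPrefix P (a ∷ (u ++ v) ++ P)) fail refl)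

  final-not-ends⇒period-prefix : ∀ v → p ≤ length v → final? v ≡ true → ends? (P ++ v) ≡ false →
    ∃[ r ] 1 ≤ r × r < p × Period r × isPrefix (drop (p ∸ r) P) v ≡ true
  final-not-ends⇒period-prefix v p≤v final-v no-ends = r , s≤s z≤n , s≤s j<P₀ , period , prefix
    where
    P-first : isPrefix P (c₀ ∷ (P₀ ++ v) ++ P) ≡ true
    P-first = subst (λ z → isPrefix P (c₀ ∷ z) ≡ true) (sym (++-assoc P₀ v P)) (isPrefix-++ P P (v ++ P) (isPrefix-refl P))
    true∧ : ∀ {b c} → b ≡ true → b ∧ c ≡ false → c ≡ false
    true∧ refl eq = eq
    shifted = final-shift P₀ v (true∧ P-first no-ends) final-v
    j = proj₁ shifted
    j<P₀ = proj₁ (proj₂ shifted)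
    occurs = proj₂ (proj₂ shifted)
    r = suc j
    r≤p : r ≤ p
    r≤p = s≤s (<⇒≤ j<P₀)
    x = drop r P
    |x| : length x ≡ p ∸ r
    |x| = length-drop r P
    period : Period r
    period = isPeriod-sound r (isPrefix-complete x P (λ k k<x →
      sym (trans (isPrefix-sound P (x ++ v ++ P) occurs k (≤-trans k<x (≤-trans (≤-reflexive |x|) (m∸n≤m p r))))
                 (at-++ˡ x (v ++ P) k k<x))))
    prefix : isPrefix (drop (p ∸ r) P) v ≡ true
    prefix = isPrefix-complete (drop (p ∸ r) P) v pointwise
      where
      pointwise : ∀ k → k < length (drop (p ∸ r) P) → at (drop (p ∸ r) P) k ≡ at v k
      pointwise k k<r′ = begin
        at (drop (p ∸ r) P) k            ≡⟨ at-drop (p ∸ r) k P ⟩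
        at P (p ∸ r + k)                 ≡⟨ isPrefix-sound P (x ++ v ++ P) occurs (p ∸ r + k) idx<p ⟩
        at (x ++ v ++ P) (p ∸ r + k)     ≡⟨ cong (λ i → at (x ++ v ++ P) (i + k)) |x| ⟨
        at (x ++ v ++ P) (length x + k)  ≡⟨ at-++ʳ x (v ++ P) k ⟩
        at (v ++ P) k                    ≡⟨ at-++ˡ v P k (≤-trans k<r (≤-trans r≤p p≤v)) ⟩
        at v k                           ∎
        where
        open ≡-Reasoning
        k<r : k < r
        k<r = subst (k <_) (length-drop-P r≤p) k<r′
        idx<p : p ∸ r + k < p
        idx<p = subst (p ∸ r + k <_) (m∸n+n≡m r≤p) (+-monoʳ-< (p ∸ r) k<r)

  π-overlap-or-long : ∀ {r} → 1 ≤ r → r < p → Period r → π ≤ r × (r + π ≤ p ⊎ p < r + r)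
  π-overlap-or-long {r} 1≤r r<p pr with r + π ℕ.≤? p
  ... | yes r+π≤p = π≤r , inj₁ r+π≤p
    where π≤r = π-minimal 1≤r (<⇒≤ r<p) pr
  ... | no r+π≰p = π≤r , inj₂ (<-≤-trans (≰⇒> r+π≰p) (+-monoʳ-≤ r π≤r))
    where π≤r = π-minimal 1≤r (<⇒≤ r<p) pr

  free-not-final-cases : ∀ v → free? v ≡ true → final? v ≡ false →
    isSuffix (take π P) v ≡ true ⊎ ∃[ r ] r < p × p < r + r × isSuffix (take r P) v ≡ true
  free-not-final-cases v free fail with free-not-final⇒period-suffix v free fail
  ... | r , 1≤r , r<p , pr , suffix with π-overlap-or-long 1≤r r<p pr
  ...   | π≤r , inj₁ r+π≤p = inj₁ (isSuffix-trans (take π P) (take r P) v (take-period-suffix π-period pr π≤r r+π≤p) suffix)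
  ...   | _ , inj₂ long = inj₂ (r , r<p , long , suffix)

  final-not-ends-cases : ∀ v → p ≤ length v → final? v ≡ true → ends? (P ++ v) ≡ false →
    isPrefix (drop (p ∸ π) P) v ≡ true ⊎ ∃[ r ] r < p × p < r + r × isPrefix (drop (p ∸ r) P) v ≡ true
  final-not-ends-cases v p≤v final-v no-ends with final-not-ends⇒period-prefix v p≤v final-v no-ends
  ... | r , 1≤r , r<p , pr , prefix with π-overlap-or-long 1≤r r<p pr
  ...   | π≤r , inj₁ r+π≤p = inj₁ (isPrefix-trans (drop (p ∸ π) P) (drop (p ∸ r) P) v (drop-period-prefix π-period pr π≤r r+π≤p) prefix)
  ...   | _ , inj₂ long = inj₂ (r , r<p , long , prefix)

module Overlaps (q : ℕ) (c₀ : Fin q) (P₀ : Word q) where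
  open Words q
  open Pattern q c₀ P₀
  open Periods q c₀ P₀

  long? : ℕ → Bool
  long? r = ⌊ p ℕ.<? r + r ⌋

  long-true : ∀ {r} → p < r + r → long? r ≡ true
  long-true {r} long with p ℕ.<? r + r
  ... | yes _ = refl
  ... | no short = contradiction long short

  freeEndingIn : Word q → Word q → ℕ
  freeEndingIn t v = if isSuffix t v then ⟦ free? v ⟧ else 0

  finalStartingWith : Word q → Word q → ℕ
  finalStartingWith s v = if isPrefix s v then ⟦ final? v ⟧ else 0

  free-pointwise : ∀ v → ⟦ free? v ⟧ ≤ ⟦ final? v ⟧ + freeEndingIn (take π P) v
                                      + sumBelow p (λ r → if long? r then freeEndingIn (take r P) v else 0)
  free-pointwise v = ⟦⟧-cover (λ r → if long? r then freeEndingIn (take r P) v else 0) cover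
    where
    cover : free? v ≡ true → final? v ≡ false →
            1 ≤ freeEndingIn (take π P) v ⊎ ∃[ r ] r < p × 1 ≤ (if long? r then freeEndingIn (take r P) v else 0)
    cover free fail with free-not-final-cases v free fail
    ... | inj₁ suffix = inj₁ (if-true-1 suffix free)
    ... | inj₂ (r , r<p , long , suffix) = inj₂ (r , r<p , if-true-≤ (long-true {r} long) (if-true-1 suffix free))

  final-pointwise : ∀ v → p ≤ length v → ⟦ final? v ⟧ ≤ ⟦ ends? (P ++ v) ⟧ + finalStartingWith (drop (p ∸ π) P) v
                                                      + sumBelow p (λ r → if long? r then finalStartingWith (drop (p ∸ r) P) v else 0)
  final-pointwise v p≤v = ⟦⟧-cover (λ r → if long? r then finalStartingWith (drop (p ∸ r) P) v else 0) cover
    where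
    cover : final? v ≡ true → ends? (P ++ v) ≡ false →
            1 ≤ finalStartingWith (drop (p ∸ π) P) v ⊎ ∃[ r ] r < p × 1 ≤ (if long? r then finalStartingWith (drop (p ∸ r) P) v else 0)
    cover final-v no-ends with final-not-ends-cases v p≤v final-v no-ends
    ... | inj₁ prefix = inj₁ (if-true-1 prefix final-v)
    ... | inj₂ (r , r<p , long , prefix) = inj₂ (r , r<p , if-true-≤ (long-true {r} long) (if-true-1 prefix final-v))

  sumWords-freeEndingIn : ∀ t k → length t ≤ k → sumWords k (freeEndingIn t) ≤ #free (k ∸ length t)
  sumWords-freeEndingIn t k t≤k = begin
    sumWords k (freeEndingIn t)                       ≡⟨ cong (λ m → sumWords m (freeEndingIn t)) (m∸n+n≡m t≤k) ⟨
    sumWords (k ∸ length t + length t) (freeEndingIn t) ≡⟨ sumWords-suffix t (k ∸ length t) (λ v → ⟦ free? v ⟧) ⟩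
    sumWords (k ∸ length t) (λ u → ⟦ free? (u ++ t) ⟧) ≤⟨ sumWords-mono (k ∸ length t) (λ u _ → drop-suffix u) ⟩
    #free (k ∸ length t)                              ∎
    where
    open ≤-Reasoning
    drop-suffix : ∀ u → ⟦ free? (u ++ t) ⟧ ≤ ⟦ free? u ⟧
    drop-suffix u with free? (u ++ t) in free-ut
    ... | false = z≤n
    ... | true rewrite free-++ˡ u t free-ut = ≤-refl

  sumWords-finalStartingWith : ∀ s k → length s ≤ k → sumWords k (finalStartingWith s) ≤ #final (k ∸ length s)
  sumWords-finalStartingWith s k s≤k = begin
    sumWords k (finalStartingWith s)                  ≡⟨ cong (λ m → sumWords m (finalStartingWith s)) (m+[n∸m]≡n s≤k) ⟨
    sumWords (length s + (k ∸ length s)) (finalStartingWith s) ≡⟨ sumWords-prefix s (k ∸ length s) (λ v → ⟦ final? v ⟧) ⟩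
    sumWords (k ∸ length s) (λ u → ⟦ final? (s ++ u) ⟧) ≤⟨ sumWords-mono (k ∸ length s) (λ u _ → drop-prefix u) ⟩
    #final (k ∸ length s)                             ∎
    where
    open ≤-Reasoning
    drop-prefix : ∀ u → ⟦ final? (s ++ u) ⟧ ≤ ⟦ final? u ⟧
    drop-prefix u with final? (s ++ u) in final-su
    ... | false = z≤n
    ... | true rewrite final-++ s u final-su = ≤-refl

  -- Z k is covered by Y, by A words overlapping P by its shortest period, and by B r words overlapping P
  -- by a long period r.
  record OverlapSplit (Z : ℕ → ℕ) (Y k : ℕ) : Set where
    field
      A : ℕ
      B : ℕ → ℕ
      split : Z k ≤ Y + A + sumBelow p B
      A-bound : A ≤ Z (k ∸ π)
      B-bound : ∀ r → r < p → B r ≤ (if long? r then Z (k ∸ r) else 0)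

  sumWords-freeEndingIn-take : ∀ {r} k → r ≤ p → r ≤ k → sumWords k (freeEndingIn (take r P)) ≤ #free (k ∸ r)
  sumWords-freeEndingIn-take {r} k r≤p r≤k = subst (λ j → sumWords k (freeEndingIn (take r P)) ≤ #free (k ∸ j)) (length-take-P r≤p)
    (sumWords-freeEndingIn (take r P) k (≤-trans (≤-reflexive (length-take-P r≤p)) r≤k))

  sumWords-finalStartingWith-drop : ∀ {r} M → r ≤ p → r ≤ M → sumWords M (finalStartingWith (drop (p ∸ r) P)) ≤ #final (M ∸ r)
  sumWords-finalStartingWith-drop {r} M r≤p r≤M = subst (λ j → sumWords M (finalStartingWith (drop (p ∸ r) P)) ≤ #final (M ∸ j)) (length-drop-P r≤p)
    (sumWords-finalStartingWith (drop (p ∸ r) P) M (≤-trans (≤-reflexive (length-drop-P r≤p)) r≤M))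

  #free-split : ∀ k → p ≤ k → OverlapSplit #free (#final k) k
  #free-split k p≤k = record
    { A = sumWords k (freeEndingIn (take π P))
    ; B = λ r → sumWords k (λ v → if long? r then freeEndingIn (take r P) v else 0)
    ; split = ≤-trans (sumWords-mono k (λ v _ → free-pointwise v))
                      (≤-reflexive (trans (sumWords-+ k _ _) (cong₂ _+_ (sumWords-+ k _ _) (sumWords-sumBelow k p _))))
    ; A-bound = sumWords-freeEndingIn-take k π≤p (≤-trans π≤p p≤k)
    ; B-bound = λ r r<p → ≤-trans (≤-reflexive (sumWords-if k (long? r) (freeEndingIn (take r P))))
                                  (if-mono (long? r) (sumWords-freeEndingIn-take k (<⇒≤ r<p) (≤-trans (<⇒≤ r<p) p≤k)))
    }

  #final-split : ∀ M → p ≤ M → OverlapSplit #final (#ends (p + M)) M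
  #final-split M p≤M = record
    { A = sumWords M (finalStartingWith (drop (p ∸ π) P))
    ; B = λ r → sumWords M (λ v → if long? r then finalStartingWith (drop (p ∸ r) P) v else 0)
    ; split = ≤-trans (sumWords-mono M (λ v |v| → final-pointwise v (subst (p ≤_) (sym |v|) p≤M)))
                      (≤-trans (≤-reflexive (trans (sumWords-+ M _ _) (cong₂ _+_ (sumWords-+ M _ _) (sumWords-sumBelow M p _))))
                               (+-monoˡ-≤ _ (+-monoˡ-≤ _ ends-after-P)))
    ; A-bound = sumWords-finalStartingWith-drop M π≤p (≤-trans π≤p p≤M)
    ; B-bound = λ r r<p → ≤-trans (≤-reflexive (sumWords-if M (long? r) (finalStartingWith (drop (p ∸ r) P))))
                                  (if-mono (long? r) (sumWords-finalStartingWith-drop M (<⇒≤ r<p) (≤-trans (<⇒≤ r<p) p≤M)))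
    }
    where
    ends-after-P : sumWords M (λ v → ⟦ ends? (P ++ v) ⟧) ≤ #ends (p + M)
    ends-after-P = begin
      sumWords M (λ v → ⟦ ends? (P ++ v) ⟧)                          ≡⟨ sumWords-prefix P M (λ w → ⟦ ends? w ⟧) ⟨
      sumWords (p + M) (λ w → if isPrefix P w then ⟦ ends? w ⟧ else 0) ≤⟨ sumWords-mono (p + M) {g = λ w → ⟦ ends? w ⟧} (λ w _ → if-≤ (isPrefix P w) ⟦ ends? w ⟧) ⟩
      #ends (p + M)                                                   ∎
      where open ≤-Reasoning

-- Growth rates

module Growth (q : ℕ) (2≤q : 2 ≤ q) (c₀ : Fin q) (P₀ : Word q) (32≤p : 32 ≤ suc (length P₀)) where
  open Words q
  open Pattern q c₀ P₀
  open Periods q c₀ P₀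
  open Overlaps q c₀ P₀

  l : ℕ
  l = length P₀

  m : ℕ
  m = q ^ l

  t : ℕ
  t = m ∸ 1

  α : ℕ
  α = q * t

  instance
    q≢0 : NonZero q
    q≢0 = >-nonZero (<-trans (s≤s z≤n) 2≤q)

  m≡1+t : m ≡ suc t
  m≡1+t = sym (trans (+-comm 1 t) (m∸n+n≡m (m^n>0 q l)))

  31≤l : 31 ≤ l
  31≤l = ≤-pred 32≤p

  2l≤m : 2 * l ≤ suc t
  2l≤m = ≤-trans (2*n≤2^n l) (≤-trans (^-monoˡ-≤ l 2≤q) (≤-reflexive m≡1+t))

  3≤t : 3 ≤ t
  3≤t = ≤-pred (≤-trans (*-monoʳ-≤ 2 (≤-trans (s≤s (s≤s z≤n)) 31≤l)) 2l≤m)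

  instance
    α≢0 : NonZero α
    α≢0 = m*n≢0 q t {{q≢0}} {{>-nonZero (<-trans (s≤s z≤n) 3≤t)}}

  m*m^l≤q*α^l : m * m ^ l ≤ q * α ^ l
  m*m^l≤q*α^l = begin
    q ^ l * m ^ l             ≡⟨ cong (λ z → q ^ l * z ^ l) m≡1+t ⟩
    q ^ l * suc t ^ l         ≤⟨ *-monoʳ-≤ (q ^ l) ([1+t]^n≤2*t^n t l 2l≤m) ⟩
    q ^ l * (2 * t ^ l)       ≤⟨ *-monoʳ-≤ (q ^ l) (*-monoˡ-≤ (t ^ l) 2≤q) ⟩
    q ^ l * (q * t ^ l)       ≡⟨ x∙yz≈y∙xz (q ^ l) q (t ^ l) ⟩
    q * (q ^ l * t ^ l)       ≡⟨ cong (q *_) ([m*n]^k≡m^k*n^k q t l) ⟨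
    q * α ^ l                 ∎
    where open ≤-Reasoning

  α*x+q*x≡m*[q*x] : ∀ x → α * x + q * x ≡ m * (q * x)
  α*x+q*x≡m*[q*x] x = begin
    q * t * x + q * x  ≡⟨ *-distribʳ-+ x (q * t) q ⟨
    (q * t + q) * x    ≡⟨ cong (_* x) (trans (+-comm (q * t) q) (sym (*-suc q t))) ⟩
    q * suc t * x      ≡⟨ cong (λ z → q * z * x) m≡1+t ⟨
    q * m * x          ≡⟨ trans (cong (_* x) (*-comm q m)) (*-assoc m q x) ⟩
    m * (q * x)        ∎
    where open ≡-Reasoning

  -- #free (k+1) = q #free k − #start (k+1), and #start (k+1) ≤ #free (k+1−p) ≤ (m/α)^l #free k ≤ (q/m) #free k
  -- by the induction hypothesis below k.
  #free-ratio : ∀ k → α * #free k ≤ m * #free (suc k)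
  #free-ratio = <-rec (λ k → α * #free k ≤ m * #free (suc k)) step
    where
    step : ∀ k → (∀ {j} → j < k → α * #free j ≤ m * #free (suc j)) → α * #free k ≤ m * #free (suc k)
    step k ih with suc k ℕ.<? p
    ... | yes 1+k<p = begin
      q * t * #free k      ≤⟨ *-monoˡ-≤ (#free k) (*-monoʳ-≤ q (≤-trans (n≤1+n t) (≤-reflexive (sym m≡1+t)))) ⟩
      q * m * #free k      ≡⟨ trans (cong (_* #free k) (*-comm q m)) (*-assoc m q (#free k)) ⟩
      m * (q * #free k)    ≡⟨ cong (m *_) no-start ⟨
      m * #free (suc k)    ∎
      where
      open ≤-Reasoning
      no-start : #free (suc k) ≡ q * #free k
      no-start = trans (sym (+-identityʳ _)) (trans (cong (_+_ (#free (suc k))) (sym (#start-short (suc k) 1+k<p))) (#free-step k))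
    ... | no 1+k≮p = +-cancelʳ-≤ (q * #free k) _ _ (begin
      α * #free k + q * #free k                  ≡⟨ α*x+q*x≡m*[q*x] (#free k) ⟩
      m * (q * #free k)                          ≡⟨ cong (m *_) (#free-step k) ⟨
      m * (#free (suc k) + #start (suc k))       ≡⟨ *-distribˡ-+ m _ _ ⟩
      m * #free (suc k) + m * #start (suc k)     ≤⟨ +-monoʳ-≤ (m * #free (suc k)) (*-monoʳ-≤ m start≤) ⟩
      m * #free (suc k) + m * #free a            ≤⟨ +-monoʳ-≤ (m * #free (suc k)) m*#free-a≤ ⟩
      m * #free (suc k) + q * #free k            ∎)
      where
      open ≤-Reasoning
      p≤1+k = ≮⇒≥ 1+k≮p
      a = suc k ∸ p
      a+l≡k : a + l ≡ k
      a+l≡k = m∸n+n≡m (≤-pred p≤1+k)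
      start≤ : #start (suc k) ≤ #free a
      start≤ = subst (λ z → #start z ≤ #free a) (m+[n∸m]≡n p≤1+k) (#start≤#free a)
      iterated : α ^ l * #free a ≤ m ^ l * #free k
      iterated = subst (λ z → α ^ l * #free a ≤ m ^ l * #free z) a+l≡k
                   (growth-iterate #free α m a l (λ j _ j<a+l → ih (subst (j <_) a+l≡k j<a+l)))
      m*#free-a≤ : m * #free a ≤ q * #free k
      m*#free-a≤ = *-cancelˡ-≤ (α ^ l) {{m^n≢0 α l}} (begin
        α ^ l * (m * #free a)     ≡⟨ x∙yz≈y∙xz (α ^ l) m (#free a) ⟩
        m * (α ^ l * #free a)     ≤⟨ *-monoʳ-≤ m iterated ⟩
        m * (m ^ l * #free k)     ≡⟨ *-assoc m (m ^ l) (#free k) ⟨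
        m * m ^ l * #free k       ≤⟨ *-monoˡ-≤ (#free k) m*m^l≤q*α^l ⟩
        q * α ^ l * #free k       ≡⟨ trans (cong (_* #free k) (*-comm q (α ^ l))) (*-assoc (α ^ l) q (#free k)) ⟩
        α ^ l * (q * #free k)     ∎)


  #free-growth : ∀ k → 3 * #free k ≤ 2 * #free (suc k)
  #free-growth k = *-cancelˡ-≤ m {{m^n≢0 q l}} (begin
    m * (3 * #free k)        ≡⟨ x∙yz≈y∙xz m 3 (#free k) ⟩
    3 * (m * #free k)        ≡⟨ *-assoc 3 m (#free k) ⟨
    3 * m * #free k          ≤⟨ *-monoˡ-≤ (#free k) 3m≤2α ⟩
    2 * α * #free k          ≡⟨ *-assoc 2 α (#free k) ⟩
    2 * (α * #free k)        ≤⟨ *-monoʳ-≤ 2 (#free-ratio k) ⟩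
    2 * (m * #free (suc k))  ≡⟨ x∙yz≈y∙xz 2 m _ ⟩
    m * (2 * #free (suc k))  ∎)
    where
    open ≤-Reasoning
    regroup : ∀ t → t + 3 * t ≡ 2 * (2 * t)
    regroup = solve-∀
    3m≤2α : 3 * m ≤ 2 * α
    3m≤2α = begin
      3 * m          ≡⟨ cong (3 *_) m≡1+t ⟩
      3 * suc t      ≡⟨ *-suc 3 t ⟩
      3 + 3 * t      ≤⟨ +-monoˡ-≤ (3 * t) 3≤t ⟩
      t + 3 * t      ≡⟨ regroup t ⟩
      2 * (2 * t)    ≤⟨ *-monoʳ-≤ 2 (*-monoˡ-≤ t 2≤q) ⟩
      2 * (q * t)    ∎

  #free-back : ∀ k j → j ≤ k → 3 ^ j * #free (k ∸ j) ≤ 2 ^ j * #free k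
  #free-back k j j≤k = subst (λ z → 3 ^ j * #free (k ∸ j) ≤ 2 ^ j * #free z) (m∸n+n≡m j≤k)
                         (growth-iterate #free 3 2 (k ∸ j) j (λ i _ _ → #free-growth i))

  long-decay : ∀ r → p < r + r → 12 * p * 2 ^ r ≤ 3 ^ r
  long-decay r p<2r = ≤-trans (*-monoˡ-≤ (2 ^ r) (≤-trans (*-monoʳ-≤ 12 (<⇒≤ p<2r)) (≤-reflexive (12*2r r))))
                              (24*r*2^r≤3^r r 16≤r)
    where
    12*2r : ∀ r → 12 * (r + r) ≡ 24 * r
    12*2r = solve-∀
    16≤r : 16 ≤ r
    16≤r = ≮⇒≥ (λ r<16 → <⇒≱ (≤-trans (≤ᵇ⇒≤ 31 33 _) (≤-trans (s≤s 32≤p) p<2r)) (+-mono-≤ (≤-pred r<16) (≤-pred r<16)))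

  -- The factor (2/3)^r of a long overlap beats the p possible values of r.
  overlap-absorb : (Z : ℕ → ℕ) (Y k : ℕ) → (∀ j → j ≤ p → 3 ^ j * Z (k ∸ j) ≤ 2 ^ j * Z k) →
                   OverlapSplit Z Y k → Z k ≤ 4 * Y
  overlap-absorb Z Y k back split = absorb {F = Y} {S = sumBelow p S.B} S.split S.A-bound 3Z≤2Z 12∑≤Z
    where
    module S = OverlapSplit split
    3Z≤2Z : 3 * Z (k ∸ π) ≤ 2 * Z k
    3Z≤2Z = growth-weaken π 1 (Z (k ∸ π)) (Z k) (s≤s (s≤s z≤n)) 1≤π (back π π≤p)
    long-term : ∀ r → r < p → 12 * p * (if long? r then Z (k ∸ r) else 0) ≤ Z k
    long-term r r<p with p ℕ.<? r + r
    ... | no _ = ≤-trans (≤-reflexive (*-zeroʳ (12 * p))) z≤n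
    ... | yes p<2r = *-cancelˡ-≤ (2 ^ r) {{m^n≢0 2 r}} (begin
      2 ^ r * (12 * p * Z (k ∸ r))   ≡⟨ x∙yz≈y∙xz (2 ^ r) (12 * p) _ ⟩
      12 * p * (2 ^ r * Z (k ∸ r))   ≡⟨ *-assoc (12 * p) (2 ^ r) _ ⟨
      12 * p * 2 ^ r * Z (k ∸ r)     ≤⟨ *-monoˡ-≤ (Z (k ∸ r)) (long-decay r p<2r) ⟩
      3 ^ r * Z (k ∸ r)              ≤⟨ back r (<⇒≤ r<p) ⟩
      2 ^ r * Z k                    ∎)
      where open ≤-Reasoning
    12∑≤Z : 12 * sumBelow p S.B ≤ Z k
    12∑≤Z = *-cancelˡ-≤ p {{>-nonZero (s≤s z≤n)}} (begin
      p * (12 * sumBelow p S.B)                                     ≡⟨ *-assoc p 12 (sumBelow p S.B) ⟨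
      p * 12 * sumBelow p S.B                                       ≡⟨ cong (_* sumBelow p S.B) (*-comm p 12) ⟩
      12 * p * sumBelow p S.B                                       ≤⟨ *-monoʳ-≤ (12 * p) (sumBelow-mono p S.B-bound) ⟩
      12 * p * sumBelow p (λ r → if long? r then Z (k ∸ r) else 0)  ≤⟨ *-sumBelow≤ p (12 * p) (Z k) (λ r → if long? r then Z (k ∸ r) else 0) long-term ⟩
      p * Z k                                                       ∎)
      where open ≤-Reasoning

  #free≤4*#final : ∀ k → p ≤ k → #free k ≤ 4 * #final k
  #free≤4*#final k p≤k = overlap-absorb #free (#final k) k (λ j j≤p → #free-back k j (≤-trans j≤p p≤k)) (#free-split k p≤k)

  -- #final (k+1) = q #final k − #ends (k+1), and #ends (k+1) ≤ #final (k+1−p) is tiny by the growth of #free.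
  #final-growth : ∀ k → p ≤ k → 3 * #final k ≤ 2 * #final (suc k)
  #final-growth k p≤k = +-cancelʳ-≤ (#final k) (3 * #final k) (2 * #final (suc k)) (begin
    3 * #final k + #final k               ≡⟨ regroup (#final k) ⟩
    2 * (2 * #final k)                    ≤⟨ *-monoʳ-≤ 2 (*-monoˡ-≤ (#final k) 2≤q) ⟩
    2 * (q * #final k)                    ≡⟨ cong (2 *_) (#final-step k) ⟨
    2 * (#final (suc k) + #ends (suc k))  ≡⟨ *-distribˡ-+ 2 (#final (suc k)) (#ends (suc k)) ⟩
    2 * #final (suc k) + 2 * #ends (suc k) ≤⟨ +-monoʳ-≤ (2 * #final (suc k)) (≤-trans (*-monoʳ-≤ 2 ends≤) 2*#final-a≤) ⟩
    2 * #final (suc k) + #final k         ∎)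
    where
    open ≤-Reasoning
    regroup : ∀ F → 3 * F + F ≡ 2 * (2 * F)
    regroup = solve-∀
    a = suc k ∸ p
    ends≤ : #ends (suc k) ≤ #final a
    ends≤ = subst (λ z → #ends z ≤ #final a) (m+[n∸m]≡n (≤-trans p≤k (n≤1+n k))) (#ends≤#final a)
    l≤k : l ≤ k
    l≤k = ≤-trans (n≤1+n l) p≤k
    8*2^l≤3^l : 8 * 2 ^ l ≤ 3 ^ l
    8*2^l≤3^l = ≤-trans (*-monoˡ-≤ (2 ^ l) (≤-trans (≤ᵇ⇒≤ 8 12 _) (*-monoʳ-≤ 12 (≤-trans (s≤s z≤n) 32≤p))))
                        (long-decay l (≤-trans (≤-reflexive (+-comm 2 l)) (+-monoʳ-≤ l (≤-trans (s≤s (s≤s z≤n)) 31≤l))))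
    regroup′ : ∀ x F → 2 * (x * (4 * F)) ≡ 8 * x * F
    regroup′ = solve-∀
    2*#final-a≤ : 2 * #final a ≤ #final k
    2*#final-a≤ = *-cancelˡ-≤ (3 ^ l) {{m^n≢0 3 l}} (begin
      3 ^ l * (2 * #final a)       ≡⟨ x∙yz≈y∙xz (3 ^ l) 2 (#final a) ⟩
      2 * (3 ^ l * #final a)       ≤⟨ *-monoʳ-≤ 2 (*-monoʳ-≤ (3 ^ l) (#final≤#free a)) ⟩
      2 * (3 ^ l * #free a)        ≤⟨ *-monoʳ-≤ 2 (#free-back k l l≤k) ⟩
      2 * (2 ^ l * #free k)        ≤⟨ *-monoʳ-≤ 2 (*-monoʳ-≤ (2 ^ l) (#free≤4*#final k p≤k)) ⟩
      2 * (2 ^ l * (4 * #final k)) ≡⟨ regroup′ (2 ^ l) (#final k) ⟩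
      8 * 2 ^ l * #final k         ≤⟨ *-monoˡ-≤ (#final k) 8*2^l≤3^l ⟩
      3 ^ l * #final k             ∎)

  #final-back : ∀ M j → j ≤ p → p + p ≤ M → 3 ^ j * #final (M ∸ j) ≤ 2 ^ j * #final M
  #final-back M j j≤p 2p≤M = subst (λ z → 3 ^ j * #final (M ∸ j) ≤ 2 ^ j * #final z) (m∸n+n≡m j≤M)
      (growth-iterate #final 3 2 (M ∸ j) j (λ i M∸j≤i _ → #final-growth i (≤-trans p≤M∸j M∸j≤i)))
    where
    j≤M : j ≤ M
    j≤M = ≤-trans j≤p (≤-trans (m≤m+n p p) 2p≤M)
    p≤M∸j : p ≤ M ∸ j
    p≤M∸j = ≤-trans (≤-reflexive (sym (m+n∸n≡m p p))) (≤-trans (∸-monoˡ-≤ p 2p≤M) (∸-monoʳ-≤ M j≤p))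

  #final≤4*#ends : ∀ M → p + p ≤ M → #final M ≤ 4 * #ends (p + M)
  #final≤4*#ends M 2p≤M = overlap-absorb #final (#ends (p + M)) M (λ j j≤p → #final-back M j j≤p 2p≤M)
                                         (#final-split M (≤-trans (m≤m+n p p) 2p≤M))

  #free≤16*#ends : ∀ M → p + p ≤ M → #free M ≤ 16 * #ends (p + M)
  #free≤16*#ends M 2p≤M = begin
    #free M                 ≤⟨ #free≤4*#final M (≤-trans (m≤m+n p p) 2p≤M) ⟩
    4 * #final M            ≤⟨ *-monoʳ-≤ 4 (#final≤4*#ends M 2p≤M) ⟩
    4 * (4 * #ends (p + M)) ≡⟨ *-assoc 4 4 (#ends (p + M)) ⟨
    16 * #ends (p + M)      ∎
    where open ≤-Reasoning

  h : ℕ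
  h = q ^ (l ∸ 1)

  m≡q*h : m ≡ q * h
  m≡q*h = cong (q ^_) (sym (trans (+-comm 1 (l ∸ 1)) (m∸n+n≡m (≤-trans (s≤s z≤n) 31≤l))))

  q^M≤2^[q^4]*#free : ∀ M → M ≤ q ^ 4 * h → q ^ M ≤ 2 ^ (q ^ 4) * #free M
  q^M≤2^[q^4]*#free M M≤q⁴h = *-cancelˡ-≤ (m ^ M) {{m^n≢0 m M {{m^n≢0 q l}}}} (begin
    m ^ M * q ^ M                 ≡⟨ *-comm (m ^ M) (q ^ M) ⟩
    q ^ M * m ^ M                 ≡⟨ cong (λ z → q ^ M * z ^ M) m≡1+t ⟩
    q ^ M * suc t ^ M             ≤⟨ *-monoʳ-≤ (q ^ M) ([1+t]^n≤2^c*t^n t h (q ^ 4) M 2h≤1+t M≤q⁴h) ⟩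
    q ^ M * (2 ^ c * t ^ M)       ≡⟨ x∙yz≈y∙xz (q ^ M) (2 ^ c) (t ^ M) ⟩
    2 ^ c * (q ^ M * t ^ M)       ≡⟨ cong (2 ^ c *_) ([m*n]^k≡m^k*n^k q t M) ⟨
    2 ^ c * α ^ M                 ≤⟨ *-monoʳ-≤ (2 ^ c) α^M≤m^M*#free ⟩
    2 ^ c * (m ^ M * #free M)     ≡⟨ x∙yz≈y∙xz (2 ^ c) (m ^ M) (#free M) ⟩
    m ^ M * (2 ^ c * #free M)     ∎)
    where
    open ≤-Reasoning
    c = q ^ 4
    2h≤1+t : 2 * h ≤ suc t
    2h≤1+t = ≤-trans (*-monoˡ-≤ h 2≤q) (≤-reflexive (trans (sym m≡q*h) m≡1+t))
    α^M≤m^M*#free : α ^ M ≤ m ^ M * #free M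
    α^M≤m^M*#free = ≤-trans (≤-reflexive (sym (*-identityʳ (α ^ M)))) (growth-iterate #free α m 0 M (λ j _ _ → #free-ratio j))

  q^M≤K*#ends : ∀ M → p + p ≤ M → M ≤ q ^ 4 * h → q ^ M ≤ 2 ^ (q ^ 4) * 16 * #ends (p + M)
  q^M≤K*#ends M 2p≤M M≤q⁴h = begin
    q ^ M                              ≤⟨ q^M≤2^[q^4]*#free M M≤q⁴h ⟩
    2 ^ (q ^ 4) * #free M              ≤⟨ *-monoʳ-≤ (2 ^ (q ^ 4)) (#free≤16*#ends M 2p≤M) ⟩
    2 ^ (q ^ 4) * (16 * #ends (p + M)) ≡⟨ *-assoc (2 ^ (q ^ 4)) 16 _ ⟨
    2 ^ (q ^ 4) * 16 * #ends (p + M)   ∎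
    where open ≤-Reasoning

module Synchronized (q : ℕ) (c₀ : Fin q) (P₀ : Word q) where
  open Words q
  open Pattern q c₀ P₀

  final-no-occurrence : ∀ v → final? v ≡ true → ∀ j → j < length v → isPrefix P (drop j (v ++ P)) ≡ false
  final-no-occurrence (a ∷ v) final-v zero _ with isPrefix P (a ∷ v ++ P)
  ... | false = refl
  ... | true = not-true (∧-conicalˡ (not true) (final? v) final-v) refl
  final-no-occurrence (a ∷ v) final-v (suc j) (s≤s j<v) = final-no-occurrence v (∧-conicalʳ _ _ final-v) j j<v

  goodUpTo-zero : ∀ w N → isPrefix P w ≡ true → goodUpTo P w N 0 ≡ true
  goodUpTo-zero w N P≼w rewrite take-≟-isPrefix P w | P≼w = refl

  goodUpTo-suc : ∀ w N i → isPrefix P (drop (suc i) w) ≡ ⌊ suc i ℕ.≟ N ⌋ → goodUpTo P w N i ≡ true →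
                 goodUpTo P w N (suc i) ≡ true
  goodUpTo-suc w N i occurs good rewrite take-≟-isPrefix P (drop (suc i) w) | occurs | good with suc i ℕ.≟ N
  ... | yes _ = refl
  ... | no _ = refl

  goodUpTo-ends : ∀ u → ends? u ≡ true → ∀ i → i ≤ length u → goodUpTo P (u ++ P) (length u) i ≡ true
  goodUpTo-ends (a ∷ v) ends-u zero _ = goodUpTo-zero (a ∷ v ++ P) (suc (length v)) (∧-conicalˡ _ _ ends-u)
  goodUpTo-ends (a ∷ v) ends-u (suc i) i<u =
    goodUpTo-suc (a ∷ v ++ P) (suc (length v)) i occurs (goodUpTo-ends (a ∷ v) ends-u i (≤-trans (n≤1+n i) i<u))
    where
    occurs : isPrefix P (drop (suc i) (a ∷ v ++ P)) ≡ ⌊ suc i ℕ.≟ suc (length v) ⌋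
    occurs with suc i ℕ.≟ suc (length v)
    ... | yes refl = trans (cong (isPrefix P) (drop-length-++ (a ∷ v) P)) (isPrefix-refl P)
    ... | no i≢v = final-no-occurrence v (∧-conicalʳ _ _ ends-u) i (≤-pred (≤∧≢⇒< i<u i≢v))

  #ends≤G : ∀ N → #ends N ≤ G q P N
  #ends≤G N = begin
    #ends N                                                           ≤⟨ sumWords-mono N pointwise ⟩
    sumWords N (λ u → ⟦ isPSync P N (u ++ P) ⟧)                      ≡⟨ sumWords-suffix P N (λ w → ⟦ isPSync P N w ⟧) ⟨
    sumWords (N + p) (λ w → if isSuffix P w then ⟦ isPSync P N w ⟧ else 0) ≤⟨ sumWords-mono (N + p) (λ w _ → if-≤ (isSuffix P w) _) ⟩
    sumWords (N + p) (λ w → ⟦ isPSync P N w ⟧)                       ≡⟨ count-allWords (N + p) (isPSync P N) ⟨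
    G q P N                                                           ∎
    where
    open ≤-Reasoning
    pointwise : ∀ u → length u ≡ N → ⟦ ends? u ⟧ ≤ ⟦ isPSync P N (u ++ P) ⟧
    pointwise u |u| with ends? u in ends-u
    ... | false = z≤n
    ... | true rewrite sym |u| | goodUpTo-ends u ends-u (length u) ≤-refl = ≤-refl

module Main (q : ℕ) (2≤q : 2 ≤ q) where

  instance
    q≢0 : NonZero q
    q≢0 = >-nonZero (<-trans (s≤s z≤n) 2≤q)

  -- p₀ forces 32 ≤ p and 15 q p ≤ q^p, hence N ≥ 3 p; D collects K and the factor (5 q)² from q^p ≤ 5 q n.
  p₀ : ℕ
  p₀ = 30 * q + 32

  K : ℕ
  K = 2 ^ (q ^ 4) * 16

  D : ℕ
  D = K * (25 * (q * q))

  instance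
    D≢0 : NonZero D
    D≢0 = m*n≢0 K (25 * (q * q)) {{m*n≢0 (2 ^ (q ^ 4)) 16 {{m^n≢0 2 (q ^ 4)}}}} {{m*n≢0 25 (q * q) {{_}} {{m*n≢0 q q}}}}

  module _ {p N : ℕ} (p₀<p : p₀ < p) (q^p≤ : q ^ p ≤ suc (4 * (q * N))) where

    15qp≤q^p : 15 * q * p ≤ q ^ p
    15qp≤q^p = ≤-trans (m*n≤2^n (15 * q) p (≤-trans (≤-reflexive (sym (*-assoc 2 15 q))) (≤-trans (m≤m+n (30 * q) 32) (<⇒≤ p₀<p))))
                       (^-monoˡ-≤ p 2≤q)

    3p≤N : 3 * p ≤ N
    3p≤N = ≮⇒≥ λ N<3p → <⇒≱ (≤-trans (growth N<3p) q^p≤) ≤-refl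
      where
      open ≤-Reasoning
      expand : ∀ q N → 4 * q + 4 * (q * N) ≡ 4 * q * suc N
      expand = solve-∀
      regroup : ∀ q p → 4 * q * (3 * p) ≡ 12 * q * p
      regroup = solve-∀
      growth : N < 3 * p → suc (4 * (q * N)) < q ^ p
      growth N<3p = begin-strict
        suc (4 * (q * N))      ≤⟨ +-monoˡ-≤ (4 * (q * N)) (≤-trans (s≤s z≤n) (*-monoʳ-≤ 4 (<-trans (s≤s z≤n) 2≤q))) ⟩
        4 * q + 4 * (q * N)    ≡⟨ expand q N ⟩
        4 * q * suc N          ≤⟨ *-monoʳ-≤ (4 * q) N<3p ⟩
        4 * q * (3 * p)        ≡⟨ regroup q p ⟩
        12 * q * p             <⟨ *-monoˡ-< p {{>-nonZero (≤-trans (s≤s z≤n) p₀<p)}} (*-monoˡ-< q (≤ᵇ⇒≤ 13 15 _)) ⟩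
        15 * q * p             ≤⟨ 15qp≤q^p ⟩
        q ^ p                  ∎

    q^p≤5q[N+p] : q ^ p ≤ 5 * q * (N + p)
    q^p≤5q[N+p] = begin
      q ^ p                   ≤⟨ q^p≤ ⟩
      suc (4 * (q * N))       ≤⟨ +-monoˡ-≤ (4 * (q * N)) (*-mono-≤ {1} {q} {1} {N} (<-trans (s≤s z≤n) 2≤q) 1≤N) ⟩
      q * N + 4 * (q * N)     ≡⟨ regroup q N ⟩
      5 * q * N               ≤⟨ *-monoʳ-≤ (5 * q) (m≤m+n N p) ⟩
      5 * q * (N + p)         ∎
      where
      open ≤-Reasoning
      regroup : ∀ q N → q * N + 4 * (q * N) ≡ 5 * q * N
      regroup = solve-∀
      1≤N : 1 ≤ N
      1≤N = ≤-trans (≤-trans (s≤s z≤n) p₀<p) (≤-trans (m≤n*m p 3) 3p≤N)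

  q^[N+p]≤D*G*[N+p]² : (c₀ : Fin q) (P₀ : Word q) (N : ℕ) → p₀ < suc (length P₀) →
    q ^ suc (length P₀) ≤ suc (4 * ((q ∸ 1) * N)) → N < q ^ suc (suc (suc (length P₀))) →
    q ^ (N + suc (length P₀)) ≤ D * (G q (c₀ ∷ P₀) N * ((N + suc (length P₀)) * (N + suc (length P₀))))
  q^[N+p]≤D*G*[N+p]² c₀ P₀ N p₀<p q^p≤ N<q^[2+p] = begin
    q ^ (N + p)                         ≡⟨ cong (λ z → q ^ (z + p)) p+M≡N ⟨
    q ^ (p + M + p)                     ≡⟨ split ⟩
    q ^ M * q ^ p * q ^ p               ≤⟨ *-mono-≤ (*-mono-≤ q^M≤K*G (q^p≤5q[N+p] p₀<p q^p≤′)) (q^p≤5q[N+p] p₀<p q^p≤′) ⟩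
    K * G′ * (5 * q * n) * (5 * q * n)  ≡⟨ regroup K G′ q n ⟩
    D * (G′ * (n * n))                  ∎
    where
    open ≤-Reasoning
    p = suc (length P₀)
    n = N + p
    G′ = G q (c₀ ∷ P₀) N
    q^p≤′ : q ^ p ≤ suc (4 * (q * N))
    q^p≤′ = ≤-trans q^p≤ (s≤s (*-monoʳ-≤ 4 (*-monoˡ-≤ N (m∸n≤m q 1))))
    32≤p : 32 ≤ p
    32≤p = ≤-trans (m≤n+m 32 (30 * q)) (<⇒≤ p₀<p)
    open Growth q 2≤q c₀ P₀ 32≤p using (q^M≤K*#ends; h; l; 31≤l)
    open Synchronized q c₀ P₀ using (#ends≤G)
    open Pattern q c₀ P₀ using (#ends)
    M = N ∸ p
    p≤N : p ≤ N
    p≤N = ≤-trans (m≤n*m p 3) (3p≤N p₀<p q^p≤′)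
    p+M≡N : p + M ≡ N
    p+M≡N = m+[n∸m]≡n p≤N
    triple : ∀ p → p + p + p ≡ 3 * p
    triple = solve-∀
    2p≤M : p + p ≤ M
    2p≤M = ≤-trans (≤-reflexive (sym (m+n∸n≡m (p + p) p))) (∸-monoˡ-≤ p (≤-trans (≤-reflexive (triple p)) (3p≤N p₀<p q^p≤′)))
    M≤q⁴h : M ≤ q ^ 4 * h
    M≤q⁴h = ≤-trans (m∸n≤m N p) (≤-trans (<⇒≤ N<q^[2+p]) (≤-reflexive (trans (cong (q ^_) (sym 4+[l-1]≡2+p)) (^-distribˡ-+-* q 4 (l ∸ 1)))))
      where
      4+[l-1]≡2+p : 4 + (l ∸ 1) ≡ suc (suc p)
      4+[l-1]≡2+p = cong (λ z → suc (suc (suc z))) (trans (+-comm 1 (l ∸ 1)) (m∸n+n≡m (≤-trans (s≤s z≤n) 31≤l)))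
    q^M≤K*G : q ^ M ≤ K * G′
    q^M≤K*G = ≤-trans (q^M≤K*#ends M 2p≤M M≤q⁴h) (*-monoʳ-≤ K (subst (λ z → #ends (p + M) ≤ G q (c₀ ∷ P₀) z) p+M≡N (#ends≤G (p + M))))
    split : q ^ (p + M + p) ≡ q ^ M * q ^ p * q ^ p
    split = trans (^-distribˡ-+-* q (p + M) p) (cong (_* q ^ p) (trans (^-distribˡ-+-* q p M) (*-comm (q ^ p) (q ^ M))))
    regroup : ∀ K G q n → K * G * (5 * q * n) * (5 * q * n) ≡ K * (25 * (q * q)) * (G * (n * n))
    regroup = solve-∀

  N₀ : ℕ
  N₀ = q ^ (2 + p₀)

  p₀<p : ∀ N p → N₀ < N → pCondition q N p → p₀ < p
  p₀<p N p N₀<N (_ , upper) = +-cancelˡ-< 2 p₀ p (^-cancelʳ-< q 2≤q (<-trans N₀<N (N<q^[2+p] q N p 2≤q upper)))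

  d : ℚ
  d = (+ 1) / D

  0<d : 0ℚ ℚ.< d
  0<d = *<*⇒/</ 0 1 1 D (s≤s z≤n)

  d*X≤Y : ∀ {X Y} → X ≤ D * Y → d ℚ.* ((+ X) / 1) ℚ.≤ (+ Y) / 1
  d*X≤Y {X} {Y} X≤DY = subst (ℚ._≤ (+ Y) / 1) (sym (/*/ 1 D X 1)) (*≤*⇒/≤/ (1 * X) (D * 1) Y 1 {{m*n≢0 D 1}} cross)
    where
    cross : 1 * X * 1 ≤ Y * (D * 1)
    cross = subst₂ _≤_ (sym (trans (*-identityʳ (1 * X)) (*-identityˡ X))) (trans (*-comm D Y) (cong (Y *_) (sym (*-identityʳ D)))) X≤DY

lemma6 : (q : ℕ) → 2 ≤ q →
    Σ ℕ (λ N₀ → Σ ℚ (λ d → (0ℚ ℚ.< d) ×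
    ((N p : ℕ) → pCondition q N p → N₀ < N → (P : Vec (Fin q) p) →
    d ℚ.* (+ (q ^ (N + p)) / 1)
    ℚ.≤ (+ (G q (toList P) N * ((N + p) * (N + p))) / 1))))
lemma6 q 2≤q = N₀ , d , 0<d , bound
  where
  open Main q 2≤q
  bound : (N p : ℕ) → pCondition q N p → N₀ < N → (P : Vec (Fin q) p) →
          d ℚ.* (+ (q ^ (N + p)) / 1) ℚ.≤ (+ (G q (toList P) N * ((N + p) * (N + p)))) / 1
  bound N zero pc N₀<N [] = contradiction (p₀<p N 0 N₀<N pc) λ ()
  bound N (suc p) pc@(lower , upper) N₀<N (c₀ ∷ P₀) with toList P₀ | length-toList P₀
  ... | P₀′ | refl = d*X≤Y (q^[N+p]≤D*G*[N+p]² c₀ P₀′ N (p₀<p N p′ N₀<N pc) (q^p≤1+4[q-1]N q N p′ 2≤q lower) (N<q^[2+p] q N p′ 2≤q upper))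
    where p′ = suc (length P₀′)
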